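{- Let $s\ge1$ and $\mathbf{k}=(k_1,\dots,k_s)\in\mathbb{Z}_{\ge1}^s$. Then \[F_{\mathbf{k}}(t)=\sum_{\mathbf{w}\in W_{s-1}}F_{r_{\mathbf{w}}(\mathbf{k})*\tilde{\mathbf{w}}}(t)\cdot t^{|\mathbf{w}|}.\]
   Context: Ladder diagrams: $Q^+$ is the directed graph with vertex set $\mathbb{Z}_{\ge0}^2$ and directed edges $((i,j),(i,j+1))$, $((i,j),(i+1,j))$. For a sequence $\mathbf{m}=(m_1,\dots,m_p)$ of positive integers with $n=\sum m_i$ and $n_i=m_1+\dots+m_i$ ($n_0=0$), let $T_{\mathbf{m}}=\{(n_i,n-n_i):0\le i\le p\}$ (terminal vertices) and let $\Gamma_{\mathbf{m}}$ be the induced subgraph of $Q^+$ on $\{(a,b):a\le c,\ b\le d\text{ for some }(c,d)\in T_{\mathbf{m}}\}$. For a sequence of nonnegative integers, $\Gamma_{\mathbf{m}}:=\Gamma_{\underline{\mathbf{m}}}$ where $\underline{\mathbf{m}}$ is obtained by deleting zero entries (the empty sequence gives the single vertex $(0,0)$). A positive path is a shortest directed path in $\Gamma_{\mathbf{m}}$ from $(0,0)$ to a terminal vertex; a face of $\Gamma_{\mathbf{m}}$ is a subgraph containing all terminal vertices that is a union of positive paths; its dimension is $\operatorname{rank}H_1$ as a one-dimensional CW-complex; $F_{\mathbf{m}}(t)=\sum_{\gamma}t^{\dim\gamma}$ over all faces $\gamma$ of $\Gamma_{\mathbf{m}}$. $W_{s-1}$ is the set of sequences $\mathbf{w}=((\alpha_1,\beta_1),\dots,(\alpha_{s-1},\beta_{s-1}))$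 with each $(\alpha_i,\beta_i)\in\{(1,0),(0,1),(1,1)\}$. Set $\alpha_s=\beta_0=1$. Define $r_{\mathbf{w}}(\mathbf{k})=(k_1'',\dots,k_s'')$ with $k_i''=k_i+1-\alpha_i-\beta_{i-1}$, $\tilde{\mathbf{w}}=(\alpha_1\beta_1,\dots,\alpha_{s-1}\beta_{s-1})$, and $|\mathbf{w}|=\sum_{i=1}^{s-1}\alpha_i\beta_i$. For $\mathbf{a}=(a_1,\dots,a_s)$ and $\mathbf{b}=(b_1,\dots,b_{s-1})$, $\mathbf{a}*\mathbf{b}=(a_1,b_1,a_2,b_2,\dots,a_{s-1},b_{s-1},a_s)$. -}

module Defs where

open import Data.Bool using (Bool; true; false; _∧_; _∨_; not; if_then_else_)
open import Data.Nat using (ℕ; zero; suc; _+_; _∸_; _≤ᵇ_; _≡ᵇ_)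
import Data.Nat as ℕ
open import Data.Nat.ListAction using (sum)
open import Data.List.Base using (List; []; _∷_; map; length; filter; filterᵇ;
  deduplicate; concatMap; _++_; cartesianProduct; upTo; foldr)
open import Data.Bool.ListAction using (any; all; or)
import Data.List.Properties as LP
import Data.Bool as B
import Data.Product.Properties as PP
open import Data.Product using (_×_; _,_; proj₁; proj₂)
open import Data.Vec using (Vec; []; _∷_)
import Data.Vec as Vec
open import Relation.Nullary using (Dec)
open import Relation.Binary.PropositionalEquality using (_≡_)

-- Vertices of Q⁺ and directed edges.
-- An edge is encoded by its tail and a direction:
--   (v , true)  : v = (i,j) ↦ (i+1,j)
--   (v , false) : v = (i,j) ↦ (i,j+1)

Vertex : Set
Vertex = ℕ × ℕ

Edge : Set
Edge = Vertex × Bool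

step : Vertex → Bool → Vertex
step (i , j) true  = (suc i , j)
step (i , j) false = (i , suc j)

_==V_ : Vertex → Vertex → Bool
(a , b) ==V (c , d) = (a ≡ᵇ c) ∧ (b ≡ᵇ d)

_==E_ : Edge → Edge → Bool
(v , x) ==E (w , y) = (v ==V w) ∧ (if x then y else not y)

dropZeros : List ℕ → List ℕ
dropZeros [] = []
dropZeros (zero ∷ xs) = dropZeros xs
dropZeros (suc x ∷ xs) = suc x ∷ dropZeros xs

partialSums : List ℕ → List ℕ
partialSums [] = 0 ∷ []
partialSums (x ∷ xs) = 0 ∷ map (x +_) (partialSums xs)

terminals : List ℕ → List Vertex
terminals m = map (λ a → (a , sum m ∸ a)) (partialSums m)

isTerminal : List ℕ → Vertex → Bool
isTerminal m v = any (v ==V_) (terminals m)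

inΓ : List ℕ → Vertex → Bool
inΓ m (a , b) = any (λ t → (a ≤ᵇ proj₁ t) ∧ (b ≤ᵇ proj₂ t)) (terminals m)

-- Directed paths from (0,0): sequences of steps (true = right, false = up).

allSteps : ℕ → List (List Bool)
allSteps zero = [] ∷ []
allSteps (suc n) = concatMap (λ p → (true ∷ p) ∷ (false ∷ p) ∷ []) (allSteps n)

pathVerticesFrom : Vertex → List Bool → List Vertex
pathVerticesFrom v [] = v ∷ []
pathVerticesFrom v (d ∷ ds) = v ∷ pathVerticesFrom (step v d) ds

pathEdgesFrom : Vertex → List Bool → List Edge
pathEdgesFrom v [] = []
pathEdgesFrom v (d ∷ ds) = (v , d) ∷ pathEdgesFrom (step v d) ds

endpoint : Vertex → List Bool → Vertex
endpoint v [] = v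
endpoint v (d ∷ ds) = endpoint (step v d) ds

origin : Vertex
origin = (0 , 0)

-- Positive paths of Γ_m (m without zeros): directed paths from (0,0)
-- of length n = Σ m (the shortest possible length to any terminal vertex),
-- all of whose vertices lie in Γ_m (so all edges lie in the induced
-- subgraph Γ_m), ending at a terminal vertex.
positivePaths : List ℕ → List (List Bool)
positivePaths m =
  filterᵇ (λ p → isTerminal m (endpoint origin p) ∧ all (inΓ m) (pathVerticesFrom origin p))
          (allSteps (sum m))

-- Subgraphs, represented canonically by characteristic vectors over the
-- box [0..n]×[0..n] (which contains Γ_m) and over all edges with tail in it.

boxVertices : ℕ → List Vertex
boxVertices n = cartesianProduct (upTo (suc n)) (upTo (suc n))

boxEdges : ℕ → List Edge
boxEdges n = cartesianProduct (boxVertices n) (true ∷ false ∷ [])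

Subgraph : Set
Subgraph = List Bool × List Bool

subsets : {A : Set} → List A → List (List A)
subsets [] = [] ∷ []
subsets (x ∷ xs) = let r = subsets xs in r ++ map (x ∷_) r

unionGraph : ℕ → List (List Bool) → Subgraph
unionGraph n S =
  ( map (λ v → any (λ p → any (v ==V_) (pathVerticesFrom origin p)) S) (boxVertices n)
  , map (λ e → any (λ p → any (e ==E_) (pathEdgesFrom origin p)) S) (boxEdges n) )

memberV : ℕ → Subgraph → Vertex → Bool
memberV n γ v = or (zipB (map (v ==V_) (boxVertices n)) (proj₁ γ))
  where
  zipB : List Bool → List Bool → List Bool
  zipB (x ∷ xs) (y ∷ ys) = (x ∧ y) ∷ zipB xs ys
  zipB _ _ = []

containsTerminals : List ℕ → Subgraph → Bool
containsTerminals m γ = all (memberV (sum m) γ) (terminals m)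

_≟G_ : (γ δ : Subgraph) → Dec (γ ≡ δ)
_≟G_ = PP.≡-dec (LP.≡-dec B._≟_) (LP.≡-dec B._≟_)

facesPos : List ℕ → List Subgraph
facesPos m = deduplicate _≟G_
  (filterᵇ (containsTerminals m) (map (unionGraph (sum m)) (subsets (positivePaths m))))

countTrue : List Bool → ℕ
countTrue bs = length (filterᵇ (λ b → b) bs)

-- dim γ = rank H₁(γ) = #E − #V + #(connected components); every face is
-- connected (each of its vertices is joined to (0,0) inside γ), so
-- dim γ = #E − #V + 1.
dim : Subgraph → ℕ
dim γ = (countTrue (proj₂ γ) + 1) ∸ countTrue (proj₁ γ)

Poly : Set
Poly = ℕ → ℕ

-- coefficient of t^d in F_m(t), m a sequence of nonnegative integers
F : List ℕ → Poly
F m d = length (filterᵇ (λ γ → dim γ ≡ᵇ d) (facesPos (dropZeros m)))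

zeroP : Poly
zeroP _ = 0

_⊕_ : Poly → Poly → Poly
(P ⊕ Q) d = P d + Q d

mulT : ℕ → Poly → Poly
mulT zero P d = P d
mulT (suc e) P zero = 0
mulT (suc e) P (suc d) = mulT e P d

sumP : List Poly → Poly
sumP = foldr _⊕_ zeroP

data Letter : Set where
  l10 l01 l11 : Letter

α β : Letter → ℕ
α l10 = 1
α l01 = 0
α l11 = 1
β l10 = 0
β l01 = 1
β l11 = 1

allW : (r : ℕ) → List (Vec Letter r)
allW zero = [] ∷ []
allW (suc r) = concatMap (λ w → (l10 ∷ w) ∷ (l01 ∷ w) ∷ (l11 ∷ w) ∷ []) (allW r)

wTilde : {r : ℕ} → Vec Letter r → Vec ℕ r
wTilde = Vec.map (λ l → α l ℕ.* β l)

wSize : {r : ℕ} → Vec Letter r → ℕ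
wSize w = Vec.sum (wTilde w)

-- r_w(k)_i = k_i + 1 − α_i − β_{i−1}, with α_s = β_0 = 1
-- (always ≥ 0 when all k_i ≥ 1, so truncated subtraction is exact)
rW : {r : ℕ} → Vec Letter r → Vec ℕ (suc r) → Vec ℕ (suc r)
rW w k = Vec.zipWith (λ ki ab → ki + 1 ∸ proj₁ ab ∸ proj₂ ab) k
           (Vec.zip (Vec.map α w Vec.∷ʳ 1) (1 ∷ Vec.map β w))

interleave : {r : ℕ} → Vec ℕ (suc r) → Vec ℕ r → List ℕ
interleave {zero} (a ∷ []) [] = a ∷ []
interleave {suc r} (a ∷ as) (b ∷ bs) = a ∷ b ∷ interleave as bs

-- A face γ of Γ_k is a union of positive paths, and the last edges of these
-- paths are the edges of γ entering the terminal vertices. At an interior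
-- terminal they are the horizontal edge, the vertical edge or both, i.e. a
-- letter (1,0), (0,1) or (1,1); the first terminal can only be entered
-- vertically and the last one horizontally. Deleting the terminals and these
-- final edges from a face with word w leaves a face of the ladder whose
-- terminals are the tails of the final edges, and these tails are exactly the
-- terminals of Γ_{r_w(k) * w̃}; conversely, attaching the final edges of w to a
-- face of Γ_{r_w(k) * w̃} gives a face of Γ_k with word w. The top level has
-- s + 1 vertices and s + 1 + |w| edges, so dim = #E − #V + 1 grows by |w|, and
-- summing over the words w gives the formula.

module Submission where

open import Data.Bool using (Bool; true; false; T; _∧_; _∨_; if_then_else_)
open import Data.Bool.ListAction using (any; all; or)
open import Data.Bool.Properties using (T-∧; T-∨; T?)
open import Data.Empty using (⊥; ⊥-elim)
open import Data.List.Base as List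
  using (List; []; _∷_; _++_; [_]; length; map; filter; filterᵇ; concatMap; zipWith; upTo; cartesianProduct)
open import Data.List.Membership.Propositional using (_∈_; find; lose)
open import Data.List.Membership.Propositional.Properties
  using (∈-map⁺; ∈-map⁻; ∈-filter⁺; ∈-filter⁻; ∈-++⁺ˡ; ∈-++⁺ʳ; ∈-++⁻; ∈-concatMap⁺; ∈-concatMap⁻;
         ∈-upTo⁺; ∈-upTo⁻; ∈-cartesianProduct⁺; ∈-cartesianProduct⁻; ∈-deduplicate⁺; ∈-deduplicate⁻)
import Data.List.Properties as List
open import Data.List.Membership.DecPropositional (List.≡-dec Data.Bool._≟_) using (_∈?_)
open import Data.List.Relation.Unary.All as All using ([]; _∷_)
open import Data.List.Relation.Unary.All.Properties using (all⁺; all⁻)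
open import Data.List.Relation.Unary.Any as Any using (here; there)
open import Data.List.Relation.Unary.Any.Properties using (any⁺; any⁻)
open import Data.List.Relation.Unary.AllPairs using ([]; _∷_)
open import Data.List.Relation.Unary.Unique.DecPropositional.Properties using (deduplicate-!)
open import Data.List.Relation.Unary.Unique.Propositional using (Unique)
import Data.List.Relation.Unary.Unique.Propositional.Properties as Unique
open import Data.Nat using (ℕ; zero; suc; _+_; _*_; _∸_; _≤_; _<_; z≤n; s≤s; _≡ᵇ_; _≤ᵇ_)
open import Data.Nat.ListAction using (sum)
import Data.Nat.ListAction.Properties as NatList
open import Data.Nat.Properties
open import Data.Nat.Solver using (module +-*-Solver)
open +-*-Solver using (solve; _:+_; _:=_; con)
open import Data.Product using (∃; ∃₂; _×_; _,_; proj₁; proj₂; uncurry)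
import Data.Product.Properties as Product
open import Data.Sum using (_⊎_; inj₁; inj₂; [_,_]′)
import Data.Sum as Sum
open import Data.Vec using (Vec; []; _∷_; toList)
import Data.Vec.Base as Vec
import Data.Vec.Properties as Vec
open import Data.Vec.Relation.Unary.All using (All; []; _∷_)
open import Function.Base using (_∘_)
open import Function.Bundles using (_⇔_; mk⇔; Equivalence)
open import Relation.Binary.PropositionalEquality hiding ([_])
open import Relation.Nullary using (Dec; yes; no; does)

open import Defs

T-ext : ∀ {a b} → (T a → T b) → (T b → T a) → a ≡ b
T-ext {false} {false} _ _ = refl
T-ext {false} {true}  _ g = ⊥-elim (g _)
T-ext {true}  {false} f _ = ⊥-elim (f _)
T-ext {true}  {true}  _ _ = refl

T-∨⁻ : ∀ a {b} → T (a ∨ b) → T a ⊎ T b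
T-∨⁻ a = Equivalence.to (T-∨ {a})

T-∧⁻ : ∀ a {b} → T (a ∧ b) → T a × T b
T-∧⁻ a = Equivalence.to (T-∧ {a})

module _ {A : Set} where

  ∈-filterᵇ⁺ : ∀ (f : A → Bool) {x xs} → x ∈ xs → T (f x) → x ∈ filterᵇ f xs
  ∈-filterᵇ⁺ f = ∈-filter⁺ (T? ∘ f)

  ∈-filterᵇ⁻ : ∀ (f : A → Bool) {x} xs → x ∈ filterᵇ f xs → x ∈ xs × T (f x)
  ∈-filterᵇ⁻ f xs = ∈-filter⁻ (T? ∘ f) {xs = xs}

  Unique-filterᵇ : ∀ (f : A → Bool) {xs} → Unique xs → Unique (filterᵇ f xs)
  Unique-filterᵇ f = Unique.filter⁺ (T? ∘ f)

  length-filterᵇ-∨ : ∀ (f g : A → Bool) xs → (∀ x → T (f x) → T (g x) → ⊥) →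
    length (filterᵇ (λ x → f x ∨ g x) xs) ≡ length (filterᵇ f xs) + length (filterᵇ g xs)
  length-filterᵇ-∨ f g [] _ = refl
  length-filterᵇ-∨ f g (x ∷ xs) disjoint with f x in fx | g x in gx
  ... | true  | true  = ⊥-elim (disjoint x (subst T (sym fx) _) (subst T (sym gx) _))
  ... | true  | false = cong suc (length-filterᵇ-∨ f g xs disjoint)
  ... | false | true  = trans (cong suc (length-filterᵇ-∨ f g xs disjoint)) (sym (+-suc _ _))
  ... | false | false = length-filterᵇ-∨ f g xs disjoint

  countTrue-map : ∀ (f : A → Bool) xs → countTrue (map f xs) ≡ length (filterᵇ f xs)
  countTrue-map f [] = refl
  countTrue-map f (x ∷ xs) with f x
  ... | true  = cong suc (countTrue-map f xs)
  ... | false = countTrue-map f xs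

  private
    remove : ∀ {x : A} {ys} → x ∈ ys → List A
    remove {ys = _ ∷ ys} (here _)  = ys
    remove {ys = y ∷ _}  (there p) = y ∷ remove p

    length-remove : ∀ {x : A} {ys} (p : x ∈ ys) → length ys ≡ suc (length (remove p))
    length-remove (here _)  = refl
    length-remove (there p) = cong suc (length-remove p)

    ∈-remove : ∀ {x z : A} {ys} (p : x ∈ ys) → z ∈ ys → z ≢ x → z ∈ remove p
    ∈-remove (here refl) (here refl) z≢x = ⊥-elim (z≢x refl)
    ∈-remove (here refl) (there q)   _   = q
    ∈-remove (there p)   (here refl) _   = here refl
    ∈-remove (there p)   (there q)   z≢x = there (∈-remove p q z≢x)

  length-≤-⊆ : ∀ {xs ys : List A} → Unique xs → (∀ {x} → x ∈ xs → x ∈ ys) → length xs ≤ length ys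
  length-≤-⊆ {[]}     _ _ = z≤n
  length-≤-⊆ {x ∷ xs} (x∉xs ∷ uniq) xs⊆ys =
    subst (suc (length xs) ≤_) (sym (length-remove x∈ys))
      (s≤s (length-≤-⊆ uniq (λ z∈xs → ∈-remove x∈ys (xs⊆ys (there z∈xs))
                                  (λ z≡x → All.lookup x∉xs z∈xs (sym z≡x)))))
    where x∈ys = xs⊆ys (here refl)

  length-≡-⊆⊇ : ∀ {xs ys : List A} → Unique xs → Unique ys →
    (∀ {x} → x ∈ xs → x ∈ ys) → (∀ {x} → x ∈ ys → x ∈ xs) → length xs ≡ length ys
  length-≡-⊆⊇ uniqueXs uniqueYs xs⊆ys ys⊆xs =
    ≤-antisym (length-≤-⊆ uniqueXs xs⊆ys) (length-≤-⊆ uniqueYs ys⊆xs)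

  length-filterᵇ≡ : ∀ (f : A → Bool) {xs zs} → Unique xs → Unique zs →
    (∀ {x} → x ∈ zs → x ∈ xs × T (f x)) → (∀ {x} → x ∈ xs → T (f x) → x ∈ zs) →
    length (filterᵇ f xs) ≡ length zs
  length-filterᵇ≡ f {xs} uniqueXs uniqueZs zs⊆ ⊆zs = length-≡-⊆⊇ (Unique-filterᵇ f uniqueXs) uniqueZs
    (λ x∈ → let x∈xs , fx = ∈-filterᵇ⁻ f xs x∈ in ⊆zs x∈xs fx)
    (λ x∈ → let x∈xs , fx = zs⊆ x∈ in ∈-filterᵇ⁺ f x∈xs fx)

module _ {A B : Set} where

  Unique-map⁺-local : ∀ (f : A → B) {xs} → Unique xs →
    (∀ {x y} → x ∈ xs → y ∈ xs → f x ≡ f y → x ≡ y) → Unique (map f xs)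
  Unique-map⁺-local f {[]} [] _ = []
  Unique-map⁺-local f {x ∷ xs} (x∉xs ∷ uniq) inj =
    All.tabulate fresh ∷ Unique-map⁺-local f uniq (λ p q → inj (there p) (there q))
    where
    fresh : ∀ {z} → z ∈ map f xs → f x ≢ z
    fresh z∈ fx≡z with ∈-map⁻ f z∈
    ... | y , y∈xs , refl = All.lookup x∉xs y∈xs (inj (here refl) (there y∈xs) fx≡z)

  Unique-map⇒injective : ∀ (f : A → B) {xs x y} → Unique (map f xs) → x ∈ xs → y ∈ xs → f x ≡ f y → x ≡ y
  Unique-map⇒injective f _            (here refl) (here refl) _     = refl
  Unique-map⇒injective f (fx∉ ∷ _)    (here refl) (there y∈)  fx≡fy =
    ⊥-elim (All.lookup fx∉ (∈-map⁺ f y∈) fx≡fy)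
  Unique-map⇒injective f (fy∉ ∷ _)    (there x∈)  (here refl) fx≡fy =
    ⊥-elim (All.lookup fy∉ (∈-map⁺ f x∈) (sym fx≡fy))
  Unique-map⇒injective f (_ ∷ unique) (there x∈)  (there y∈)  fx≡fy =
    Unique-map⇒injective f unique x∈ y∈ fx≡fy

  length-≤-retract : ∀ (f : A → B) (g : B → A) {xs ys} → Unique xs →
    (∀ {x} → x ∈ xs → f x ∈ ys) → (∀ {x} → x ∈ xs → g (f x) ≡ x) → length xs ≤ length ys
  length-≤-retract f g {xs} {ys} uniq into retract =
    subst (_≤ length ys) (List.length-map f xs)
      (length-≤-⊆ (Unique-map⁺-local f uniq injective) image⊆ys)
    where
    injective : ∀ {x y} → x ∈ xs → y ∈ xs → f x ≡ f y → x ≡ y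
    injective p q fx≡fy = trans (sym (retract p)) (trans (cong g fx≡fy) (retract q))
    image⊆ys : ∀ {z} → z ∈ map f xs → z ∈ ys
    image⊆ys z∈ with ∈-map⁻ f z∈
    ... | x , x∈xs , refl = into x∈xs

module CharacteristicVector {A : Set} (_==_ : A → A → Bool)
  (==⇒≡ : ∀ {x y} → T (x == y) → x ≡ y) (==-refl : ∀ x → T (x == x)) where

  bitOf : A → List A → List Bool → Bool
  bitOf x xs bs = or (zipWith _∧_ (map (x ==_) xs) bs)

  bitOf-map⁻ : ∀ (g : A → Bool) x xs → T (bitOf x xs (map g xs)) → x ∈ xs × T (g x)
  bitOf-map⁻ g x (y ∷ ys) h = [ atHead , inTail ]′ (Equivalence.to T-∨ h)
    where
    atHead : T ((x == y) ∧ g y) → x ∈ y ∷ ys × T (g x)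
    atHead h′ with Equivalence.to T-∧ h′
    ... | x==y , gy rewrite ==⇒≡ x==y = here refl , gy
    inTail : T (bitOf x ys (map g ys)) → x ∈ y ∷ ys × T (g x)
    inTail h′ = let x∈ys , gx = bitOf-map⁻ g x ys h′ in there x∈ys , gx

  bitOf-map⁺ : ∀ (g : A → Bool) {x xs} → x ∈ xs → T (g x) → T (bitOf x xs (map g xs))
  bitOf-map⁺ g {x} (here refl) gx = Equivalence.from T-∨ (inj₁ (Equivalence.from T-∧ (==-refl x , gx)))
  bitOf-map⁺ g (there x∈xs)    gx = Equivalence.from T-∨ (inj₂ (bitOf-map⁺ g x∈xs gx))

  bitOf-map : ∀ (g : A → Bool) {x xs} → x ∈ xs → bitOf x xs (map g xs) ≡ g x
  bitOf-map g {x} {xs} x∈xs = T-ext (proj₂ ∘ bitOf-map⁻ g x xs) (bitOf-map⁺ g x∈xs)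

  any-==⁻ : ∀ {x} xs → T (any (x ==_) xs) → x ∈ xs
  any-==⁻ xs h = Any.map ==⇒≡ (any⁻ _ xs h)

  any-==⁺ : ∀ {x xs} → x ∈ xs → T (any (x ==_) xs)
  any-==⁺ {x} x∈xs = any⁺ _ (Any.map (λ { refl → ==-refl x }) x∈xs)

==V⇒≡ : ∀ {u v} → T (u ==V v) → u ≡ v
==V⇒≡ {a , b} {c , d} h = let a≡c , b≡d = Equivalence.to T-∧ h in
  cong₂ _,_ (≡ᵇ⇒≡ a c a≡c) (≡ᵇ⇒≡ b d b≡d)

==V-refl : ∀ v → T (v ==V v)
==V-refl (a , b) = Equivalence.from T-∧ (≡⇒≡ᵇ a a refl , ≡⇒≡ᵇ b b refl)

==E⇒≡ : ∀ {e f} → T (e ==E f) → e ≡ f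
==E⇒≡ {u , true}  {v , true}  h = cong (_, true) (==V⇒≡ (proj₁ (Equivalence.to T-∧ h)))
==E⇒≡ {u , false} {v , false} h = cong (_, false) (==V⇒≡ (proj₁ (Equivalence.to T-∧ h)))
==E⇒≡ {u , true}  {v , false} h = ⊥-elim (proj₂ (Equivalence.to T-∧ h))
==E⇒≡ {u , false} {v , true}  h = ⊥-elim (proj₂ (Equivalence.to T-∧ h))

==E-refl : ∀ e → T (e ==E e)
==E-refl (u , true)  = Equivalence.from T-∧ (==V-refl u , _)
==E-refl (u , false) = Equivalence.from T-∧ (==V-refl u , _)

module VertexVector = CharacteristicVector _==V_ ==V⇒≡ ==V-refl
module EdgeVector = CharacteristicVector _==E_ ==E⇒≡ ==E-refl
open VertexVector using () renaming (any-==⁻ to any-==V⁻; any-==⁺ to any-==V⁺)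
open EdgeVector using () renaming (any-==⁻ to any-==E⁻; any-==⁺ to any-==E⁺)

-- memberV zips with a function local to Defs; unifying it with the
-- metavariable orZip recovers its defining clauses.
memberV≡bitOf : ∀ n γ v → memberV n γ v ≡ VertexVector.bitOf v (boxVertices n) (proj₁ γ)
memberV≡bitOf n γ v = trans unfolded (orZip≗ (map (v ==V_) (boxVertices n)) (proj₁ γ))
  where
  orZip : List Bool → List Bool → Bool
  orZip = _
  unfolded : memberV n γ v ≡ orZip (map (_==V_ v) (boxVertices n)) (proj₁ γ)
  unfolded with map (_==V_ v) (boxVertices n) | proj₁ γ
  ... | _ | _ = refl
  orZip≗ : ∀ xs ys → orZip xs ys ≡ or (zipWith _∧_ xs ys)
  orZip≗ []       _        = refl
  orZip≗ (_ ∷ _)  []       = refl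
  orZip≗ (x ∷ xs) (y ∷ ys) = cong ((x ∧ y) ∨_) (orZip≗ xs ys)

memberE : ℕ → Subgraph → Edge → Bool
memberE n γ e = EdgeVector.bitOf e (boxEdges n) (proj₂ γ)

inBox : ℕ → Vertex → Set
inBox n (a , b) = a ≤ n × b ≤ n

inBox-mono : ∀ {m n} v → m ≤ n → inBox m v → inBox n v
inBox-mono (a , b) m≤n (a≤m , b≤m) = ≤-trans a≤m m≤n , ≤-trans b≤m m≤n

∈-boxVertices⁺ : ∀ n {v} → inBox n v → v ∈ boxVertices n
∈-boxVertices⁺ n {a , b} (a≤n , b≤n) = ∈-cartesianProduct⁺ (∈-upTo⁺ (s≤s a≤n)) (∈-upTo⁺ (s≤s b≤n))

∈-boxVertices⁻ : ∀ n {v} → v ∈ boxVertices n → inBox n v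
∈-boxVertices⁻ n {a , b} v∈ with ∈-cartesianProduct⁻ (upTo (suc n)) (upTo (suc n)) v∈
... | a∈ , b∈ = ≤-pred (∈-upTo⁻ a∈) , ≤-pred (∈-upTo⁻ b∈)

∈-boxEdges⁺ : ∀ n {u} d → inBox n u → (u , d) ∈ boxEdges n
∈-boxEdges⁺ n true  u∈ = ∈-cartesianProduct⁺ (∈-boxVertices⁺ n u∈) (here refl)
∈-boxEdges⁺ n false u∈ = ∈-cartesianProduct⁺ (∈-boxVertices⁺ n u∈) (there (here refl))

∈-boxEdges⁻ : ∀ n {u d} → (u , d) ∈ boxEdges n → inBox n u
∈-boxEdges⁻ n e∈ = ∈-boxVertices⁻ n (proj₁ (∈-cartesianProduct⁻ (boxVertices n) _ e∈))

boxVertices-unique : ∀ n → Unique (boxVertices n)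
boxVertices-unique n = Unique.cartesianProduct⁺ (Unique.upTo⁺ (suc n)) (Unique.upTo⁺ (suc n))

boxEdges-unique : ∀ n → Unique (boxEdges n)
boxEdges-unique n = Unique.cartesianProduct⁺ (boxVertices-unique n) (((λ ()) ∷ []) ∷ [] ∷ [])

encode : ℕ → (Vertex → Bool) → (Edge → Bool) → Subgraph
encode n f g = map f (boxVertices n) , map g (boxEdges n)

module _ {n : ℕ} {f : Vertex → Bool} {g : Edge → Bool} where

  memberV-encode : ∀ {v} → inBox n v → memberV n (encode n f g) v ≡ f v
  memberV-encode {v} v∈ = trans (memberV≡bitOf n (encode n f g) v) (VertexVector.bitOf-map f (∈-boxVertices⁺ n v∈))

  memberV-encode⁻ : ∀ v → T (memberV n (encode n f g) v) → inBox n v × T (f v)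
  memberV-encode⁻ v h with VertexVector.bitOf-map⁻ f v (boxVertices n) (subst T (memberV≡bitOf n (encode n f g) v) h)
  ... | v∈ , fv = ∈-boxVertices⁻ n v∈ , fv

  memberE-encode : ∀ {u} d → inBox n u → memberE n (encode n f g) (u , d) ≡ g (u , d)
  memberE-encode d u∈ = EdgeVector.bitOf-map g (∈-boxEdges⁺ n d u∈)

  memberE-encode⁻ : ∀ u d → T (memberE n (encode n f g) (u , d)) → inBox n u × T (g (u , d))
  memberE-encode⁻ u d h with EdgeVector.bitOf-map⁻ g (u , d) (boxEdges n) h
  ... | e∈ , ge = ∈-boxEdges⁻ n e∈ , ge

  dim-encode : dim (encode n f g) ≡ (length (filterᵇ g (boxEdges n)) + 1) ∸ length (filterᵇ f (boxVertices n))
  dim-encode = cong₂ (λ e v → (e + 1) ∸ v) (countTrue-map g (boxEdges n)) (countTrue-map f (boxVertices n))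

encode-cong : ∀ n {f f′ g g′} → (∀ {v} → inBox n v → f v ≡ f′ v) →
  (∀ {u} d → inBox n u → g (u , d) ≡ g′ (u , d)) → encode n f g ≡ encode n f′ g′
encode-cong n f≡f′ g≡g′ = cong₂ _,_
  (List.map-cong-local (All.tabulate (f≡f′ ∘ ∈-boxVertices⁻ n)))
  (List.map-cong-local (All.tabulate (λ {e} e∈ → g≡g′ (proj₂ e) (∈-boxEdges⁻ n e∈))))

-- Lattice paths

level : Vertex → ℕ
level (a , b) = a + b

_≤V_ : Vertex → Vertex → Set
(a , b) ≤V (c , d) = a ≤ c × b ≤ d

≤V-refl : ∀ {u} → u ≤V u
≤V-refl = ≤-refl , ≤-refl

≤V-trans : ∀ {u v w} → u ≤V v → v ≤V w → u ≤V w
≤V-trans (p , q) (r , s) = ≤-trans p r , ≤-trans q s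

level≤⇒inBox : ∀ {n} v → level v ≤ n → inBox n v
level≤⇒inBox (a , b) ≤n = ≤-trans (m≤m+n a b) ≤n , ≤-trans (m≤n+m b a) ≤n

target : Edge → Vertex
target (u , d) = step u d

_≟V_ : (u v : Vertex) → Dec (u ≡ v)
_≟V_ = Product.≡-dec _≟_ _≟_

level-step : ∀ u d → level (step u d) ≡ suc (level u)
level-step (a , b) true  = refl
level-step (a , b) false = +-suc a b

≤V-step : ∀ u d → u ≤V step u d
≤V-step (a , b) true  = n≤1+n a , ≤-refl
≤V-step (a , b) false = ≤-refl , n≤1+n b

level-endpoint : ∀ v p → level (endpoint v p) ≡ level v + length p
level-endpoint v []      = sym (+-identityʳ _)
level-endpoint v (d ∷ p) = trans (level-endpoint (step v d) p)
  (trans (cong (_+ length p) (level-step v d)) (sym (+-suc _ _)))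

∈-pathVertices⇒level≤ : ∀ v p {u} → u ∈ pathVerticesFrom v p → level u ≤ level v + length p
∈-pathVertices⇒level≤ v []      (here refl) = m≤m+n _ _
∈-pathVertices⇒level≤ v (d ∷ p) (here refl) = m≤m+n _ _
∈-pathVertices⇒level≤ v (d ∷ p) {u} (there u∈) = begin
  level u                      ≤⟨ ∈-pathVertices⇒level≤ (step v d) p u∈ ⟩
  level (step v d) + length p  ≡⟨ cong (_+ length p) (level-step v d) ⟩
  suc (level v) + length p     ≡⟨ +-suc (level v) (length p) ⟨
  level v + length (d ∷ p)     ∎
  where open ≤-Reasoning

∈-pathVertices-top⇒endpoint : ∀ v p {u} → u ∈ pathVerticesFrom v p →
  level u ≡ level v + length p → u ≡ endpoint v p
∈-pathVertices-top⇒endpoint v []      (here refl) _  = refl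
∈-pathVertices-top⇒endpoint v (d ∷ p) (here refl) eq =
  ⊥-elim (m+1+n≰m (level v) (≤-reflexive (sym eq)))
∈-pathVertices-top⇒endpoint v (d ∷ p) (there u∈) eq = ∈-pathVertices-top⇒endpoint (step v d) p u∈
  (trans eq (trans (+-suc _ _) (cong (_+ length p) (sym (level-step v d)))))

start-∈-pathVertices : ∀ v p → v ∈ pathVerticesFrom v p
start-∈-pathVertices v []      = here refl
start-∈-pathVertices v (d ∷ p) = here refl

endpoint-∈-pathVertices : ∀ v p → endpoint v p ∈ pathVerticesFrom v p
endpoint-∈-pathVertices v []      = here refl
endpoint-∈-pathVertices v (d ∷ p) = there (endpoint-∈-pathVertices (step v d) p)

∈-pathVertices⇒≤endpoint : ∀ v p {u} → u ∈ pathVerticesFrom v p → u ≤V endpoint v p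
∈-pathVertices⇒≤endpoint v []      (here refl) = ≤V-refl
∈-pathVertices⇒≤endpoint v (d ∷ p) (here refl) =
  ≤V-trans (≤V-step v d) (∈-pathVertices⇒≤endpoint (step v d) p (start-∈-pathVertices (step v d) p))
∈-pathVertices⇒≤endpoint v (d ∷ p) (there u∈) = ∈-pathVertices⇒≤endpoint (step v d) p u∈

∈-pathEdges⇒∈-pathVertices : ∀ v p {e} → e ∈ pathEdgesFrom v p →
  proj₁ e ∈ pathVerticesFrom v p × target e ∈ pathVerticesFrom v p
∈-pathEdges⇒∈-pathVertices v (d ∷ p) (here refl) = here refl , there (start-∈-pathVertices (step v d) p)
∈-pathEdges⇒∈-pathVertices v (d ∷ p) (there e∈) =
  let s∈ , t∈ = ∈-pathEdges⇒∈-pathVertices (step v d) p e∈ in there s∈ , there t∈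

∈-pathVertices⇒incoming : ∀ v p {u} → u ∈ pathVerticesFrom v p → u ≢ v →
  ∃ λ e → e ∈ pathEdgesFrom v p × target e ≡ u
∈-pathVertices⇒incoming v []      (here refl) u≢v = ⊥-elim (u≢v refl)
∈-pathVertices⇒incoming v (d ∷ p) (here refl) u≢v = ⊥-elim (u≢v refl)
∈-pathVertices⇒incoming v (d ∷ p) {u} (there u∈) u≢v with u ≟V step v d
... | yes refl = (v , d) , here refl , refl
... | no u≢v′ = let e , e∈ , te≡u = ∈-pathVertices⇒incoming (step v d) p u∈ u≢v′ in e , there e∈ , te≡u

endpoint-∷ʳ : ∀ v p d → endpoint v (p List.∷ʳ d) ≡ step (endpoint v p) d
endpoint-∷ʳ v []      d = refl
endpoint-∷ʳ v (x ∷ p) d = endpoint-∷ʳ (step v x) p d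

∈-pathVertices-∷ʳ⁻ : ∀ v p d {u} → u ∈ pathVerticesFrom v (p List.∷ʳ d) →
  u ∈ pathVerticesFrom v p ⊎ u ≡ step (endpoint v p) d
∈-pathVertices-∷ʳ⁻ v []      d (here refl)         = inj₁ (here refl)
∈-pathVertices-∷ʳ⁻ v []      d (there (here refl)) = inj₂ refl
∈-pathVertices-∷ʳ⁻ v (x ∷ p) d (here refl)         = inj₁ (here refl)
∈-pathVertices-∷ʳ⁻ v (x ∷ p) d (there u∈) =
  Sum.map₁ there (∈-pathVertices-∷ʳ⁻ (step v x) p d u∈)

∈-pathVertices-∷ʳ⁺ : ∀ v p d {u} → u ∈ pathVerticesFrom v p → u ∈ pathVerticesFrom v (p List.∷ʳ d)
∈-pathVertices-∷ʳ⁺ v []      d (here refl) = here refl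
∈-pathVertices-∷ʳ⁺ v (x ∷ p) d (here refl) = here refl
∈-pathVertices-∷ʳ⁺ v (x ∷ p) d (there u∈)  = there (∈-pathVertices-∷ʳ⁺ (step v x) p d u∈)

∈-pathEdges-∷ʳ⁻ : ∀ v p d {e} → e ∈ pathEdgesFrom v (p List.∷ʳ d) →
  e ∈ pathEdgesFrom v p ⊎ e ≡ (endpoint v p , d)
∈-pathEdges-∷ʳ⁻ v []      d (here refl) = inj₂ refl
∈-pathEdges-∷ʳ⁻ v (x ∷ p) d (here refl) = inj₁ (here refl)
∈-pathEdges-∷ʳ⁻ v (x ∷ p) d (there e∈)  = Sum.map₁ there (∈-pathEdges-∷ʳ⁻ (step v x) p d e∈)

∈-pathEdges-∷ʳ⁺ : ∀ v p d {e} → e ∈ pathEdgesFrom v p → e ∈ pathEdgesFrom v (p List.∷ʳ d)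
∈-pathEdges-∷ʳ⁺ v (x ∷ p) d (here refl) = here refl
∈-pathEdges-∷ʳ⁺ v (x ∷ p) d (there e∈)  = there (∈-pathEdges-∷ʳ⁺ (step v x) p d e∈)

lastEdge-∈-pathEdges-∷ʳ : ∀ v p d → (endpoint v p , d) ∈ pathEdgesFrom v (p List.∷ʳ d)
lastEdge-∈-pathEdges-∷ʳ v []      d = here refl
lastEdge-∈-pathEdges-∷ʳ v (x ∷ p) d = there (lastEdge-∈-pathEdges-∷ʳ (step v x) p d)

∈-allSteps⁺ : ∀ p → p ∈ allSteps (length p)
∈-allSteps⁺ []      = here refl
∈-allSteps⁺ (d ∷ p) = ∈-concatMap⁺ (λ q → (true ∷ q) ∷ (false ∷ q) ∷ [])
  (Any.map (λ { refl → choice d }) (∈-allSteps⁺ p))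
  where
  choice : ∀ d → d ∷ p ∈ (true ∷ p) ∷ (false ∷ p) ∷ []
  choice true  = here refl
  choice false = there (here refl)

∈-allSteps⁻ : ∀ n {p} → p ∈ allSteps n → length p ≡ n
∈-allSteps⁻ zero    (here refl) = refl
∈-allSteps⁻ (suc n) p∈ with find (∈-concatMap⁻ (λ q → (true ∷ q) ∷ (false ∷ q) ∷ []) {xs = allSteps n} p∈)
... | q , q∈ , here refl         = cong suc (∈-allSteps⁻ n q∈)
... | q , q∈ , there (here refl) = cong suc (∈-allSteps⁻ n q∈)

-- Positive paths and faces

-- The condition `all (inΓ m)` in positivePaths is automatic: every vertex of a
-- monotone path lies below its endpoint, which is a terminal.
Positive : List ℕ → List Bool → Set
Positive m p = length p ≡ sum m × T (isTerminal m (endpoint origin p))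

∈-positivePaths⁺ : ∀ m {p} → Positive m p → p ∈ positivePaths m
∈-positivePaths⁺ m {p} (length≡ , terminal) =
  ∈-filterᵇ⁺ _ (subst (λ n → p ∈ allSteps n) length≡ (∈-allSteps⁺ p))
    (Equivalence.from T-∧ (terminal , all⁻ (inΓ m) (All.tabulate (inΓ-below ∘ ∈-pathVertices⇒≤endpoint origin p))))
  where
  inΓ-below : ∀ {u} → u ≤V endpoint origin p → T (inΓ m u)
  inΓ-below {a , b} (a≤ , b≤) = any⁺ _ (Any.map (λ { refl → Equivalence.from T-∧ (≤⇒≤ᵇ a≤ , ≤⇒≤ᵇ b≤) })
    (any-==V⁻ (terminals m) terminal))

∈-positivePaths⁻ : ∀ m {p} → p ∈ positivePaths m → Positive m p
∈-positivePaths⁻ m p∈ = let p∈allSteps , ok = ∈-filterᵇ⁻ _ (allSteps (sum m)) p∈ in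
  ∈-allSteps⁻ (sum m) p∈allSteps , proj₁ (Equivalence.to T-∧ ok)

onSomePathV : List (List Bool) → Vertex → Bool
onSomePathV S v = any (λ p → any (v ==V_) (pathVerticesFrom origin p)) S

onSomePathE : List (List Bool) → Edge → Bool
onSomePathE S e = any (λ p → any (e ==E_) (pathEdgesFrom origin p)) S

onSomePathV⁻ : ∀ S v → T (onSomePathV S v) → ∃ λ p → p ∈ S × v ∈ pathVerticesFrom origin p
onSomePathV⁻ S v h = let p , p∈ , v∈ = find (any⁻ _ S h) in p , p∈ , any-==V⁻ {v} _ v∈

onSomePathV⁺ : ∀ {S v p} → p ∈ S → v ∈ pathVerticesFrom origin p → T (onSomePathV S v)
onSomePathV⁺ {v = v} p∈ v∈ = any⁺ _ (lose p∈ (any-==V⁺ {v} v∈))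

onSomePathE⁻ : ∀ S e → T (onSomePathE S e) → ∃ λ p → p ∈ S × e ∈ pathEdgesFrom origin p
onSomePathE⁻ S e h = let p , p∈ , e∈ = find (any⁻ _ S h) in p , p∈ , any-==E⁻ {e} _ e∈

onSomePathE⁺ : ∀ {S e p} → p ∈ S → e ∈ pathEdgesFrom origin p → T (onSomePathE S e)
onSomePathE⁺ {e = e} p∈ e∈ = any⁺ _ (lose p∈ (any-==E⁺ {e} e∈))

memberV-unionGraph⁻ : ∀ n S v → T (memberV n (unionGraph n S) v) →
  ∃ λ p → p ∈ S × v ∈ pathVerticesFrom origin p
memberV-unionGraph⁻ n S v h =
  onSomePathV⁻ S v (proj₂ (memberV-encode⁻ {n} {onSomePathV S} {onSomePathE S} v h))

memberV-unionGraph⁺ : ∀ {n S v p} → length p ≡ n → p ∈ S → v ∈ pathVerticesFrom origin p →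
  T (memberV n (unionGraph n S) v)
memberV-unionGraph⁺ {n} {S} {v} {p} length≡ p∈ v∈ = subst T
  (sym (memberV-encode {n} {onSomePathV S} {onSomePathE S}
    (level≤⇒inBox v (subst (level v ≤_) length≡ (∈-pathVertices⇒level≤ origin p v∈)))))
  (onSomePathV⁺ p∈ v∈)

memberE-unionGraph⁻ : ∀ n S u d → T (memberE n (unionGraph n S) (u , d)) →
  ∃ λ p → p ∈ S × (u , d) ∈ pathEdgesFrom origin p
memberE-unionGraph⁻ n S u d h =
  onSomePathE⁻ S (u , d) (proj₂ (memberE-encode⁻ {n} {onSomePathV S} {onSomePathE S} u d h))

memberE-unionGraph⁺ : ∀ {n S u d p} → length p ≡ n → p ∈ S → (u , d) ∈ pathEdgesFrom origin p →
  T (memberE n (unionGraph n S) (u , d))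
memberE-unionGraph⁺ {n} {S} {u} {d} {p} length≡ p∈ e∈ = subst T
  (sym (memberE-encode {n} {onSomePathV S} {onSomePathE S} d (level≤⇒inBox u (subst (level u ≤_) length≡
    (∈-pathVertices⇒level≤ origin p (proj₁ (∈-pathEdges⇒∈-pathVertices origin p e∈)))))))
  (onSomePathE⁺ p∈ e∈)

unionGraph-cong : ∀ n {S₁ S₂} → (∀ {p} → p ∈ S₁ → p ∈ S₂) → (∀ {p} → p ∈ S₂ → p ∈ S₁) →
  unionGraph n S₁ ≡ unionGraph n S₂
unionGraph-cong n {S₁} {S₂} S₁⊆S₂ S₂⊆S₁ =
  encode-cong n {onSomePathV S₁} {onSomePathV S₂} {onSomePathE S₁} {onSomePathE S₂}
    (λ {v} _ → T-ext (onSomePathV-mono S₁⊆S₂ v) (onSomePathV-mono S₂⊆S₁ v))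
    (λ {u} d _ → T-ext (onSomePathE-mono S₁⊆S₂ (u , d)) (onSomePathE-mono S₂⊆S₁ (u , d)))
  where
  onSomePathV-mono : ∀ {S S′} → (∀ {p} → p ∈ S → p ∈ S′) → ∀ v → T (onSomePathV S v) → T (onSomePathV S′ v)
  onSomePathV-mono {S} S⊆S′ v h = let _ , p∈ , v∈ = onSomePathV⁻ S v h in onSomePathV⁺ (S⊆S′ p∈) v∈
  onSomePathE-mono : ∀ {S S′} → (∀ {p} → p ∈ S → p ∈ S′) → ∀ e → T (onSomePathE S e) → T (onSomePathE S′ e)
  onSomePathE-mono {S} S⊆S′ e h = let _ , p∈ , e∈ = onSomePathE⁻ S e h in onSomePathE⁺ (S⊆S′ p∈) e∈

containsTerminals⁺ : ∀ m γ → (∀ {t} → t ∈ terminals m → T (memberV (sum m) γ t)) → T (containsTerminals m γ)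
containsTerminals⁺ m γ h = all⁻ _ (All.tabulate h)

containsTerminals⁻ : ∀ m γ → T (containsTerminals m γ) → ∀ {t} → t ∈ terminals m → T (memberV (sum m) γ t)
containsTerminals⁻ m γ h = All.lookup (all⁺ _ (terminals m) h)

filter-∈-subsets : ∀ {A : Set} {P : A → Set} (P? : ∀ x → Dec (P x)) xs → filter P? xs ∈ subsets xs
filter-∈-subsets P? [] = here refl
filter-∈-subsets P? (x ∷ xs) with does (P? x)
... | true  = ∈-++⁺ʳ (subsets xs) (∈-map⁺ (x ∷_) (filter-∈-subsets P? xs))
... | false = ∈-++⁺ˡ (filter-∈-subsets P? xs)

∈-subsets⇒⊆ : ∀ {A : Set} (xs : List A) {S} → S ∈ subsets xs → ∀ {p} → p ∈ S → p ∈ xs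
∈-subsets⇒⊆ [] (here refl) ()
∈-subsets⇒⊆ (x ∷ xs) S∈ p∈ with ∈-++⁻ (subsets xs) S∈
... | inj₁ S∈′ = there (∈-subsets⇒⊆ xs S∈′ p∈)
... | inj₂ S∈′ with ∈-map⁻ (x ∷_) S∈′
...   | S′ , S′∈ , refl with p∈
...     | here refl = here refl
...     | there p∈′ = there (∈-subsets⇒⊆ xs S′∈ p∈′)

record Spanning (m : List ℕ) (S : List (List Bool)) : Set where
  field
    positive  : ∀ {p} → p ∈ S → Positive m p
    coversTerminals : T (containsTerminals m (unionGraph (sum m) S))

facesPos⁻ : ∀ m {γ} → γ ∈ facesPos m → ∃ λ S → Spanning m S × γ ≡ unionGraph (sum m) S
facesPos⁻ m γ∈ with ∈-filterᵇ⁻ (containsTerminals m) faceCandidates (∈-deduplicate⁻ _≟G_ _ γ∈)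
  where faceCandidates = map (unionGraph (sum m)) (subsets (positivePaths m))
... | γ∈unions , spans with ∈-map⁻ (unionGraph (sum m)) γ∈unions
...   | S , S∈ , refl =
  S , record { positive = ∈-positivePaths⁻ m ∘ ∈-subsets⇒⊆ (positivePaths m) S∈ ; coversTerminals = spans } , refl

facesPos⁺ : ∀ m {S} → Spanning m S → unionGraph (sum m) S ∈ facesPos m
facesPos⁺ m {S} spanning = ∈-deduplicate⁺ _≟G_ (∈-filterᵇ⁺ (containsTerminals m)
  {xs = map (unionGraph (sum m)) (subsets (positivePaths m))}
  (subst (_∈ map (unionGraph (sum m)) (subsets (positivePaths m))) same
    (∈-map⁺ (unionGraph (sum m)) (filter-∈-subsets (_∈? S) (positivePaths m))))
  (Spanning.coversTerminals spanning))
  where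
  same : unionGraph (sum m) (filter (_∈? S) (positivePaths m)) ≡ unionGraph (sum m) S
  same = unionGraph-cong (sum m) (proj₂ ∘ ∈-filter⁻ (_∈? S) {xs = positivePaths m})
    (λ p∈ → ∈-filter⁺ (_∈? S) (∈-positivePaths⁺ m (Spanning.positive spanning p∈)) p∈)

facesPos-unique : ∀ m → Unique (facesPos m)
facesPos-unique m = deduplicate-! _≟G_ (filterᵇ (containsTerminals m) (map (unionGraph (sum m)) (subsets (positivePaths m))))

spanning⁺ : ∀ m {S} → (∀ {p} → p ∈ S → Positive m p) →
  (∀ {t} → t ∈ terminals m → ∃ λ p → p ∈ S × endpoint origin p ≡ t) → Spanning m S
spanning⁺ m {S} positive reach = record
  { positive        = positive
  ; coversTerminals = containsTerminals⁺ m (unionGraph (sum m) S) λ t∈ →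
      let p , p∈ , end≡t = reach t∈ in
      memberV-unionGraph⁺ (proj₁ (positive p∈)) p∈
        (subst (_∈ pathVerticesFrom origin p) end≡t (endpoint-∈-pathVertices origin p))
  }

spanning-reach : ∀ m {S} → Spanning m S → ∀ {t} → t ∈ terminals m → level t ≡ sum m →
  ∃ λ p → p ∈ S × endpoint origin p ≡ t
spanning-reach m {S} spanning {t} t∈ level≡ =
  let p , p∈ , t∈p = memberV-unionGraph⁻ (sum m) S t
                        (containsTerminals⁻ m (unionGraph (sum m) S) (Spanning.coversTerminals spanning) t∈) in
  p , p∈ , sym (∈-pathVertices-top⇒endpoint origin p t∈p (trans level≡ (sym (proj₁ (Spanning.positive spanning p∈)))))

-- Terminal vertices

shiftedTerminals : ℕ → List ℕ → List Vertex
shiftedTerminals x m = map (λ a → (x + a , sum m ∸ a)) (partialSums m)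

shiftedTerminals-[] : ∀ x → shiftedTerminals x [] ≡ (x , 0) ∷ []
shiftedTerminals-[] x = cong (λ y → (y , 0) ∷ []) (+-identityʳ x)

shiftedTerminals-∷ : ∀ x a m → shiftedTerminals x (a ∷ m) ≡ (x , a + sum m) ∷ shiftedTerminals (x + a) m
shiftedTerminals-∷ x a m = cong₂ _∷_ (cong (_, a + sum m) (+-identityʳ x))
  (trans (sym (List.map-∘ (partialSums m)))
    (List.map-cong (λ b → cong₂ _,_ (sym (+-assoc x a b)) ([m+n]∸[m+o]≡n∸o a (sum m) b)) (partialSums m)))

shiftedTerminals-head : ∀ x m → (x , sum m) ∈ shiftedTerminals x m
shiftedTerminals-head x []      = subst ((x , 0) ∈_) (sym (shiftedTerminals-[] x)) (here refl)
shiftedTerminals-head x (a ∷ m) = subst ((x , a + sum m) ∈_) (sym (shiftedTerminals-∷ x a m)) (here refl)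

sum-dropZeros : ∀ m → sum (dropZeros m) ≡ sum m
sum-dropZeros []          = refl
sum-dropZeros (zero ∷ m)  = sum-dropZeros m
sum-dropZeros (suc a ∷ m) = cong (suc a +_) (sum-dropZeros m)

∈-shiftedTerminals-dropZeros⁻ : ∀ x m {v} → v ∈ shiftedTerminals x (dropZeros m) → v ∈ shiftedTerminals x m
∈-shiftedTerminals-dropZeros⁻ x [] v∈ = v∈
∈-shiftedTerminals-dropZeros⁻ x (zero ∷ m) {v} v∈ = subst (v ∈_) (sym (shiftedTerminals-∷ x 0 m))
  (there (subst (λ y → v ∈ shiftedTerminals y m) (sym (+-identityʳ x)) (∈-shiftedTerminals-dropZeros⁻ x m v∈)))
∈-shiftedTerminals-dropZeros⁻ x (suc a ∷ m) {v} v∈ with subst (v ∈_) (shiftedTerminals-∷ x (suc a) (dropZeros m)) v∈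
... | here refl = subst (v ∈_) (sym (shiftedTerminals-∷ x (suc a) m))
                    (here (cong (λ s → (x , suc a + s)) (sum-dropZeros m)))
... | there v∈′ = subst (v ∈_) (sym (shiftedTerminals-∷ x (suc a) m))
                    (there (∈-shiftedTerminals-dropZeros⁻ (x + suc a) m v∈′))

∈-shiftedTerminals-dropZeros⁺ : ∀ x m {v} → v ∈ shiftedTerminals x m → v ∈ shiftedTerminals x (dropZeros m)
∈-shiftedTerminals-dropZeros⁺ x [] v∈ = v∈
∈-shiftedTerminals-dropZeros⁺ x (zero ∷ m) {v} v∈ with subst (v ∈_) (shiftedTerminals-∷ x 0 m) v∈
... | here refl = ∈-shiftedTerminals-dropZeros⁺ x m (shiftedTerminals-head x m)
... | there v∈′ = ∈-shiftedTerminals-dropZeros⁺ x m (subst (λ y → v ∈ shiftedTerminals y m) (+-identityʳ x) v∈′)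
∈-shiftedTerminals-dropZeros⁺ x (suc a ∷ m) {v} v∈ with subst (v ∈_) (shiftedTerminals-∷ x (suc a) m) v∈
... | here refl = subst (v ∈_) (sym (shiftedTerminals-∷ x (suc a) (dropZeros m)))
                    (here (cong (λ s → (x , suc a + s)) (sym (sum-dropZeros m))))
... | there v∈′ = subst (v ∈_) (sym (shiftedTerminals-∷ x (suc a) (dropZeros m)))
                    (there (∈-shiftedTerminals-dropZeros⁺ (x + suc a) m v∈′))

IsComposition : ∀ {r} → Vec ℕ r → Set
IsComposition k = All (1 ≤_) k

sum-toList : ∀ {r} (k : Vec ℕ r) → sum (toList k) ≡ Vec.sum k
sum-toList []      = refl
sum-toList (a ∷ k) = cong (a +_) (sum-toList k)

1≤sum : ∀ {r} {k : Vec ℕ (suc r)} → IsComposition k → 1 ≤ Vec.sum k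
1≤sum {k = a ∷ k} (1≤a ∷ _) = ≤-trans 1≤a (m≤m+n a (Vec.sum k))

laterTerminals : ∀ {r} → ℕ → Vec ℕ (suc r) → List Vertex
laterTerminals {zero}  x (a ∷ []) = (x + a , 0) ∷ []
laterTerminals {suc r} x (a ∷ k)  = (x + a , Vec.sum k) ∷ laterTerminals (x + a) k

terminalsFrom : ∀ {r} → ℕ → Vec ℕ (suc r) → List Vertex
terminalsFrom x k = (x , Vec.sum k) ∷ laterTerminals x k

shiftedTerminals-toList : ∀ {r} x (k : Vec ℕ (suc r)) → shiftedTerminals x (toList k) ≡ terminalsFrom x k
shiftedTerminals-toList {zero} x (a ∷ []) =
  trans (shiftedTerminals-∷ x a []) (cong ((x , a + 0) ∷_) (shiftedTerminals-[] (x + a)))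
shiftedTerminals-toList {suc r} x (a ∷ k) = trans (shiftedTerminals-∷ x a (toList k))
  (cong₂ (λ s ts → (x , a + s) ∷ ts) (sum-toList k) (shiftedTerminals-toList (x + a) k))

∈⇒isTerminal : ∀ {r} (k : Vec ℕ (suc r)) {v} → v ∈ terminalsFrom 0 k → T (isTerminal (toList k) v)
∈⇒isTerminal k {v} v∈ = any-==V⁺ {v} (subst (v ∈_) (sym (shiftedTerminals-toList 0 k)) v∈)

level-laterTerminals : ∀ {r} x (k : Vec ℕ (suc r)) {t} → t ∈ laterTerminals x k → level t ≡ x + Vec.sum k
level-laterTerminals {zero}  x (a ∷ []) (here refl) = trans (+-identityʳ _) (cong (x +_) (sym (+-identityʳ a)))
level-laterTerminals {suc r} x (a ∷ k)  (here refl) = +-assoc x a (Vec.sum k)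
level-laterTerminals {suc r} x (a ∷ k)  (there t∈)  =
  trans (level-laterTerminals (x + a) k t∈) (+-assoc x a (Vec.sum k))

level-terminalsFrom : ∀ {r} x (k : Vec ℕ (suc r)) {t} → t ∈ terminalsFrom x k → level t ≡ x + Vec.sum k
level-terminalsFrom x k (here refl) = refl
level-terminalsFrom x k (there t∈)  = level-laterTerminals x k t∈

<proj₁-laterTerminals : ∀ {r} x {k : Vec ℕ (suc r)} → IsComposition k →
  ∀ {t} → t ∈ laterTerminals x k → x < proj₁ t
<proj₁-laterTerminals {zero}  x {a ∷ []} (1≤a ∷ []) (here refl) = m<m+n x 1≤a
<proj₁-laterTerminals {suc r} x {a ∷ k}  (1≤a ∷ _)  (here refl) = m<m+n x 1≤a
<proj₁-laterTerminals {suc r} x {a ∷ k}  (1≤a ∷ composition) (there t∈) =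
  <-trans (m<m+n x 1≤a) (<proj₁-laterTerminals (x + a) composition t∈)

terminalsFrom-unique : ∀ {r} x {k : Vec ℕ (suc r)} → IsComposition k → Unique (terminalsFrom x k)
terminalsFrom-unique {zero}  x {a ∷ []} composition =
  All.tabulate (λ t∈ t≡ → <-irrefl (cong proj₁ t≡) (<proj₁-laterTerminals x composition t∈)) ∷ [] ∷ []
terminalsFrom-unique {suc r} x {a ∷ k} composition@(_ ∷ composition′) =
  All.tabulate (λ t∈ t≡ → <-irrefl (cong proj₁ t≡) (<proj₁-laterTerminals x composition t∈))
  ∷ terminalsFrom-unique (x + a) composition′

length-terminalsFrom : ∀ {r} x (k : Vec ℕ (suc r)) → length (terminalsFrom x k) ≡ suc (suc r)
length-terminalsFrom {zero}  x (a ∷ []) = refl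
length-terminalsFrom {suc r} x (a ∷ k)  = cong suc (length-terminalsFrom (x + a) k)

-- Final edges and the reduced sequence r_w(k) * w̃

edgesInto : Letter → Vertex → List Edge
edgesInto l10 (X , Y) = ((X ∸ 1 , Y) , true) ∷ []
edgesInto l01 (X , Y) = ((X , Y ∸ 1) , false) ∷ []
edgesInto l11 (X , Y) = ((X ∸ 1 , Y) , true) ∷ ((X , Y ∸ 1) , false) ∷ []

laterLetters : ∀ {r} → ℕ → Vec Letter r → Vec ℕ (suc r) → List (Letter × Vertex)
laterLetters X []      (a ∷ []) = (l10 , (X + a , 0)) ∷ []
laterLetters X (l ∷ w) (a ∷ k)  = (l , (X + a , Vec.sum k)) ∷ laterLetters (X + a) w k

-- Every terminal paired with the letter by which it is entered: the first one
-- vertically and the last one horizontally, which is the convention β₀ = α_s = 1.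
enteringLetters : ∀ {r} → Vec Letter r → Vec ℕ (suc r) → List (Letter × Vertex)
enteringLetters w k = (l01 , (0 , Vec.sum k)) ∷ laterLetters 0 w k

edgesIntoAll : List (Letter × Vertex) → List Edge
edgesIntoAll = concatMap (uncurry edgesInto)

laterEdges : ∀ {r} → ℕ → Vec Letter r → Vec ℕ (suc r) → List Edge
laterEdges X w k = edgesIntoAll (laterLetters X w k)

finalEdges : ∀ {r} → Vec Letter r → Vec ℕ (suc r) → List Edge
finalEdges w k = edgesIntoAll (enteringLetters w k)

IsTail : Vertex → List Edge → Set
IsTail v E = ∃ λ d → (v , d) ∈ E

firstTail lastTail : Letter → Vertex → Vertex
firstTail l (X , Y) = (X ∸ α l , Y ∸ (1 ∸ α l))
lastTail  l (X , Y) = (X ∸ (1 ∸ β l) , Y ∸ β l)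

isTail-edgesInto⁻ : ∀ l T {v} → IsTail v (edgesInto l T) → v ≡ firstTail l T ⊎ v ≡ lastTail l T
isTail-edgesInto⁻ l10 T (_ , here refl)         = inj₁ refl
isTail-edgesInto⁻ l01 T (_ , here refl)         = inj₁ refl
isTail-edgesInto⁻ l11 T (_ , here refl)         = inj₁ refl
isTail-edgesInto⁻ l11 T (_ , there (here refl)) = inj₂ refl

isTail-edgesInto⁺ : ∀ l T {v} → v ≡ firstTail l T ⊎ v ≡ lastTail l T → IsTail v (edgesInto l T)
isTail-edgesInto⁺ l10 T (inj₁ refl) = true , here refl
isTail-edgesInto⁺ l10 T (inj₂ refl) = true , here refl
isTail-edgesInto⁺ l01 T (inj₁ refl) = false , here refl
isTail-edgesInto⁺ l01 T (inj₂ refl) = false , here refl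
isTail-edgesInto⁺ l11 T (inj₁ refl) = true , here refl
isTail-edgesInto⁺ l11 T (inj₂ refl) = false , there (here refl)

isTail-++⁻ : ∀ E {E′ v} → IsTail v (E ++ E′) → IsTail v E ⊎ IsTail v E′
isTail-++⁻ E (d , e∈) = Sum.map (d ,_) (d ,_) (∈-++⁻ E e∈)

isTail-++⁺ : ∀ E {E′ v} → IsTail v E ⊎ IsTail v E′ → IsTail v (E ++ E′)
isTail-++⁺ E (inj₁ (d , e∈)) = d , ∈-++⁺ˡ e∈
isTail-++⁺ E (inj₂ (d , e∈)) = d , ∈-++⁺ʳ E e∈

-- r_w(k) * w̃ after a terminal entered by l; its entry k_i + 1 − α_i − β_{i−1}
-- is written (1 ∸ β_{i−1}) + k_i ∸ α_i, which computes once the letters are known.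
reducedFrom : ∀ {r} → Letter → Vec Letter r → Vec ℕ (suc r) → List ℕ
reducedFrom l []       (a ∷ []) = (1 ∸ β l) + a ∸ 1 ∷ []
reducedFrom l (l′ ∷ w) (a ∷ k)  = (1 ∸ β l) + a ∸ α l′ ∷ α l′ * β l′ ∷ reducedFrom l′ w k

reducedEntry≡ : ∀ l l′ a → a + 1 ∸ α l′ ∸ β l ≡ (1 ∸ β l) + a ∸ α l′
reducedEntry≡ l10 l′ a = cong (_∸ α l′) (+-comm a 1)
reducedEntry≡ l01 l′ a = trans (∸-+-assoc (a + 1) (α l′) 1)
  (trans (cong₂ _∸_ (+-comm a 1) (+-comm (α l′) 1)) ([m+n]∸[m+o]≡n∸o 1 a (α l′)))
reducedEntry≡ l11 l′ a = reducedEntry≡ l01 l′ a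

-- The left-hand side is rW w k * w̃ with β₀ = 1 replaced by β l.
interleave-rW : ∀ {r} l (w : Vec Letter r) (k : Vec ℕ (suc r)) →
  interleave (Vec.zipWith (λ ki ab → ki + 1 ∸ proj₁ ab ∸ proj₂ ab) k
                          (Vec.zip (Vec.map α w Vec.∷ʳ 1) (β l ∷ Vec.map β w))) (wTilde w)
  ≡ reducedFrom l w k
interleave-rW l []       (a ∷ []) = cong [_] (reducedEntry≡ l l10 a)
interleave-rW l (l′ ∷ w) (a ∷ k)  =
  cong₂ (λ c rest → c ∷ α l′ * β l′ ∷ rest) (reducedEntry≡ l l′ a) (interleave-rW l′ w k)

α≤1 : ∀ l → α l ≤ 1
α≤1 l10 = ≤-refl
α≤1 l01 = z≤n
α≤1 l11 = ≤-refl

α≡αβ+[1∸β] : ∀ l → α l ≡ α l * β l + (1 ∸ β l)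
α≡αβ+[1∸β] l10 = refl
α≡αβ+[1∸β] l01 = refl
α≡αβ+[1∸β] l11 = refl

αβ+[Y∸β]≡Y∸[1∸α] : ∀ l {Y} → 1 ≤ Y → α l * β l + (Y ∸ β l) ≡ Y ∸ (1 ∸ α l)
αβ+[Y∸β]≡Y∸[1∸α] l10 _   = refl
αβ+[Y∸β]≡Y∸[1∸α] l01 _   = refl
αβ+[Y∸β]≡Y∸[1∸α] l11 1≤Y = m+[n∸m]≡n 1≤Y

private
  blockSum : ∀ l l′ {a Y} → 1 ≤ a → 1 ≤ Y →
    ((1 ∸ β l) + a ∸ α l′) + (Y ∸ (1 ∸ α l′)) ≡ (a + Y) ∸ β l
  blockSum l10 l10 {suc a} {suc y} _ _ = refl
  blockSum l10 l01 {suc a} {suc y} _ _ = cong suc (sym (+-suc a y))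
  blockSum l10 l11 {suc a} {suc y} _ _ = refl
  blockSum l01 l10 {suc a} {suc y} _ _ = refl
  blockSum l01 l01 {suc a} {suc y} _ _ = sym (+-suc a y)
  blockSum l01 l11 {suc a} {suc y} _ _ = refl
  blockSum l11 l10 {suc a} {suc y} _ _ = refl
  blockSum l11 l01 {suc a} {suc y} _ _ = sym (+-suc a y)
  blockSum l11 l11 {suc a} {suc y} _ _ = refl

  lastBlockSum : ∀ l {a} → 1 ≤ a → ((1 ∸ β l) + a ∸ 1) + 0 ≡ (a + 0) ∸ β l
  lastBlockSum l10 {suc a} _ = refl
  lastBlockSum l01 {suc a} _ = refl
  lastBlockSum l11 {suc a} _ = refl

sum-reducedFrom : ∀ {r} l (w : Vec Letter r) {k} → IsComposition k → sum (reducedFrom l w k) ≡ Vec.sum k ∸ β l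
sum-reducedFrom l []       {a ∷ []} (1≤a ∷ []) = lastBlockSum l 1≤a
sum-reducedFrom l (l′ ∷ w) {a ∷ k}  (1≤a ∷ composition) = begin
  ((1 ∸ β l) + a ∸ α l′) + (α l′ * β l′ + sum (reducedFrom l′ w k))
    ≡⟨ cong (λ s → ((1 ∸ β l) + a ∸ α l′) + (α l′ * β l′ + s)) (sum-reducedFrom l′ w composition) ⟩
  ((1 ∸ β l) + a ∸ α l′) + (α l′ * β l′ + (Vec.sum k ∸ β l′))
    ≡⟨ cong (((1 ∸ β l) + a ∸ α l′) +_) (αβ+[Y∸β]≡Y∸[1∸α] l′ (1≤sum composition)) ⟩
  ((1 ∸ β l) + a ∸ α l′) + (Vec.sum k ∸ (1 ∸ α l′))
    ≡⟨ blockSum l l′ 1≤a (1≤sum composition) ⟩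
  (a + Vec.sum k) ∸ β l ∎
  where open ≡-Reasoning

∈-shiftedTerminals-[]⁻ : ∀ x {v} → v ∈ shiftedTerminals x [] → v ≡ (x , 0)
∈-shiftedTerminals-[]⁻ x {v} v∈ with subst (v ∈_) (shiftedTerminals-[] x) v∈
... | here v≡ = v≡

∈-shiftedTerminals-[]⁺ : ∀ x {v} → v ≡ (x , 0) → v ∈ shiftedTerminals x []
∈-shiftedTerminals-[]⁺ x {v} v≡ = subst (v ∈_) (sym (shiftedTerminals-[] x)) (here v≡)

∈-shiftedTerminals-∷⁻ : ∀ x a m {v} → v ∈ shiftedTerminals x (a ∷ m) →
  v ≡ (x , a + sum m) ⊎ v ∈ shiftedTerminals (x + a) m
∈-shiftedTerminals-∷⁻ x a m {v} v∈ with subst (v ∈_) (shiftedTerminals-∷ x a m) v∈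
... | here v≡  = inj₁ v≡
... | there v∈′ = inj₂ v∈′

∈-shiftedTerminals-∷⁺ : ∀ x a m {v} → v ≡ (x , a + sum m) ⊎ v ∈ shiftedTerminals (x + a) m →
  v ∈ shiftedTerminals x (a ∷ m)
∈-shiftedTerminals-∷⁺ x a m {v} v∈ = subst (v ∈_) (sym (shiftedTerminals-∷ x a m)) ([ here , there ]′ v∈)

module _ (l l′ : Letter) (x′ : ℕ) {a} (1≤a : 1 ≤ a) where

  private
    X = x′ + (1 ∸ β l)
    c = (1 ∸ β l) + a ∸ α l′

  blockEnd≡firstTail-x : x′ + c ≡ X + a ∸ α l′
  blockEnd≡firstTail-x = trans (sym (+-∸-assoc x′ (≤-trans (α≤1 l′) (≤-trans 1≤a (m≤n+m a (1 ∸ β l))))))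
                               (cong (_∸ α l′) (sym (+-assoc x′ (1 ∸ β l) a)))

  nextStart≡ : x′ + c + α l′ * β l′ + (1 ∸ β l′) ≡ X + a
  nextStart≡ = begin
    x′ + c + α l′ * β l′ + (1 ∸ β l′)   ≡⟨ +-assoc (x′ + c) (α l′ * β l′) (1 ∸ β l′) ⟩
    x′ + c + (α l′ * β l′ + (1 ∸ β l′)) ≡⟨ cong₂ _+_ blockEnd≡firstTail-x (sym (α≡αβ+[1∸β] l′)) ⟩
    X + a ∸ α l′ + α l′                  ≡⟨ m∸n+n≡m (≤-trans (α≤1 l′) (≤-trans 1≤a (m≤n+m a X))) ⟩
    X + a                                ∎
    where open ≡-Reasoning

  nextStart≡lastTail-x : x′ + c + α l′ * β l′ ≡ X + a ∸ (1 ∸ β l′)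
  nextStart≡lastTail-x = trans (sym (m+n∸n≡m _ (1 ∸ β l′))) (cong (_∸ (1 ∸ β l′)) nextStart≡)

-- Here (x′ , Σk ∸ β l) is the last tail into the terminal entered by l, which
-- lies at (x′ + (1 ∸ β l) , Σk).
∈-reducedTerminals⁻ : ∀ {r} l (w : Vec Letter r) {k} → IsComposition k → ∀ x′ {v} →
  v ∈ shiftedTerminals x′ (reducedFrom l w k) →
  v ≡ (x′ , Vec.sum k ∸ β l) ⊎ IsTail v (laterEdges (x′ + (1 ∸ β l)) w k)
∈-reducedTerminals⁻ l [] {a ∷ []} composition@(1≤a ∷ []) x′ v∈
  with ∈-shiftedTerminals-∷⁻ x′ _ [] v∈
... | inj₁ refl = inj₁ (cong (x′ ,_) (sum-reducedFrom l [] composition))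
... | inj₂ v∈′ with ∈-shiftedTerminals-[]⁻ _ v∈′
...   | refl = inj₂ (true , here (cong (λ x → ((x , 0) , true)) (blockEnd≡firstTail-x l l10 x′ 1≤a)))
∈-reducedTerminals⁻ l (l′ ∷ w) {a ∷ k} composition@(1≤a ∷ composition′) x′ {v} v∈
  with ∈-shiftedTerminals-∷⁻ x′ ((1 ∸ β l) + a ∸ α l′) (α l′ * β l′ ∷ reducedFrom l′ w k) v∈
... | inj₁ refl = inj₁ (cong (x′ ,_) (sum-reducedFrom l (l′ ∷ w) composition))
... | inj₂ v∈′ with ∈-shiftedTerminals-∷⁻ (x′ + ((1 ∸ β l) + a ∸ α l′)) (α l′ * β l′) (reducedFrom l′ w k) v∈′
...   | inj₁ refl = inj₂ (isTail-++⁺ (edgesInto l′ _) (inj₁ (isTail-edgesInto⁺ l′ _ (inj₁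
                      (cong₂ _,_ (blockEnd≡firstTail-x l l′ x′ 1≤a)
                        (trans (cong (α l′ * β l′ +_) (sum-reducedFrom l′ w composition′))
                               (αβ+[Y∸β]≡Y∸[1∸α] l′ (1≤sum composition′))))))))
...   | inj₂ v∈″ with ∈-reducedTerminals⁻ l′ w composition′ _ v∈″
...     | inj₁ refl = inj₂ (isTail-++⁺ (edgesInto l′ _) (inj₁ (isTail-edgesInto⁺ l′ _ (inj₂
                        (cong (_, Vec.sum k ∸ β l′) (nextStart≡lastTail-x l l′ x′ 1≤a))))))
...     | inj₂ tail = inj₂ (isTail-++⁺ (edgesInto l′ _) (inj₂
                        (subst (λ X → IsTail v (laterEdges X w k)) (nextStart≡ l l′ x′ 1≤a) tail)))

∈-reducedTerminals⁺ : ∀ {r} l (w : Vec Letter r) {k} → IsComposition k → ∀ x′ {v} →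
  v ≡ (x′ , Vec.sum k ∸ β l) ⊎ IsTail v (laterEdges (x′ + (1 ∸ β l)) w k) →
  v ∈ shiftedTerminals x′ (reducedFrom l w k)
∈-reducedTerminals⁺ l [] {a ∷ []} composition@(1≤a ∷ []) x′ (inj₁ refl) =
  ∈-shiftedTerminals-∷⁺ x′ _ [] (inj₁ (cong (x′ ,_) (sym (sum-reducedFrom l [] composition))))
∈-reducedTerminals⁺ l [] {a ∷ []} composition@(1≤a ∷ []) x′ (inj₂ (true , here refl)) =
  ∈-shiftedTerminals-∷⁺ x′ _ [] (inj₂ (∈-shiftedTerminals-[]⁺ _
    (cong (_, 0) (sym (blockEnd≡firstTail-x l l10 x′ 1≤a)))))
∈-reducedTerminals⁺ l (l′ ∷ w) {a ∷ k} composition@(1≤a ∷ composition′) x′ {v} v∈ =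
  ∈-shiftedTerminals-∷⁺ x′ c (α l′ * β l′ ∷ reducedFrom l′ w k) (Sum.map₂ inBlock (first-or-later v∈))
  where
  c = (1 ∸ β l) + a ∸ α l′
  X = x′ + (1 ∸ β l)
  first-or-later : v ≡ (x′ , a + Vec.sum k ∸ β l) ⊎ IsTail v (laterEdges X (l′ ∷ w) (a ∷ k)) →
    v ≡ (x′ , sum (reducedFrom l (l′ ∷ w) (a ∷ k))) ⊎ IsTail v (laterEdges X (l′ ∷ w) (a ∷ k))
  first-or-later = Sum.map₁ (λ v≡ → trans v≡ (cong (x′ ,_) (sym (sum-reducedFrom l (l′ ∷ w) composition))))
  inBlock : IsTail v (laterEdges X (l′ ∷ w) (a ∷ k)) →
    v ∈ shiftedTerminals (x′ + c) (α l′ * β l′ ∷ reducedFrom l′ w k)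
  inBlock tail with isTail-++⁻ (edgesInto l′ (X + a , Vec.sum k)) tail
  ... | inj₂ later = ∈-shiftedTerminals-∷⁺ _ _ _ (inj₂ (∈-reducedTerminals⁺ l′ w composition′ _
          (inj₂ (subst (λ X′ → IsTail v (laterEdges X′ w k)) (sym (nextStart≡ l l′ x′ 1≤a)) later))))
  ... | inj₁ here′ with isTail-edgesInto⁻ l′ _ here′
  ...   | inj₁ refl = ∈-shiftedTerminals-∷⁺ _ _ _ (inj₁ (cong₂ _,_
            (sym (blockEnd≡firstTail-x l l′ x′ 1≤a))
            (sym (trans (cong (α l′ * β l′ +_) (sum-reducedFrom l′ w composition′))
                        (αβ+[Y∸β]≡Y∸[1∸α] l′ (1≤sum composition′))))))
  ...   | inj₂ refl = ∈-shiftedTerminals-∷⁺ _ _ _ (inj₂ (∈-reducedTerminals⁺ l′ w composition′ _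
            (inj₁ (cong (_, Vec.sum k ∸ β l′) (sym (nextStart≡lastTail-x l l′ x′ 1≤a))))))

reducedSequence : ∀ {r} → Vec Letter r → Vec ℕ (suc r) → List ℕ
reducedSequence w k = dropZeros (interleave (rW w k) (wTilde w))

module _ {r} (w : Vec Letter r) {k : Vec ℕ (suc r)} (composition : IsComposition k) where

  sum-reducedSequence : sum (reducedSequence w k) ≡ Vec.sum k ∸ 1
  sum-reducedSequence = trans (sum-dropZeros (interleave (rW w k) (wTilde w)))
    (trans (cong sum (interleave-rW l01 w k)) (sum-reducedFrom l01 w composition))

  isTerminal-reducedSequence⁻ : ∀ v → T (isTerminal (reducedSequence w k) v) → IsTail v (finalEdges w k)
  isTerminal-reducedSequence⁻ v h with ∈-reducedTerminals⁻ l01 w composition 0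
    (subst (λ m → v ∈ shiftedTerminals 0 m) (interleave-rW l01 w k)
      (∈-shiftedTerminals-dropZeros⁻ 0 (interleave (rW w k) (wTilde w)) (any-==V⁻ {v} _ h)))
  ... | inj₁ refl = false , here refl
  ... | inj₂ tail = isTail-++⁺ (edgesInto l01 (0 , Vec.sum k)) (inj₂ tail)

  isTerminal-reducedSequence⁺ : ∀ v → IsTail v (finalEdges w k) → T (isTerminal (reducedSequence w k) v)
  isTerminal-reducedSequence⁺ v tail = any-==V⁺ {v} (∈-shiftedTerminals-dropZeros⁺ 0 (interleave (rW w k) (wTilde w))
    (subst (λ m → v ∈ shiftedTerminals 0 m) (sym (interleave-rW l01 w k))
      (∈-reducedTerminals⁺ l01 w composition 0 (first-or-later (isTail-++⁻ (edgesInto l01 (0 , Vec.sum k)) tail)))))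
    where
    first-or-later : IsTail v (edgesInto l01 (0 , Vec.sum k)) ⊎ IsTail v (laterEdges 0 w k) →
      v ≡ (0 , Vec.sum k ∸ 1) ⊎ IsTail v (laterEdges 0 w k)
    first-or-later (inj₁ (_ , here refl)) = inj₁ refl
    first-or-later (inj₂ tail′)           = inj₂ tail′

target-edgesInto : ∀ l {X Y e} → α l ≤ X → β l ≤ Y → e ∈ edgesInto l (X , Y) → target e ≡ (X , Y)
target-edgesInto l10 {suc X} {Y}     _ _ (here refl)         = refl
target-edgesInto l01 {X}     {suc Y} _ _ (here refl)         = refl
target-edgesInto l11 {suc X} {suc Y} _ _ (here refl)         = refl
target-edgesInto l11 {suc X} {suc Y} _ _ (there (here refl)) = refl

edgesInto-nonempty : ∀ l {X Y} → α l ≤ X → β l ≤ Y → ∃ λ e → e ∈ edgesInto l (X , Y) × target e ≡ (X , Y)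
edgesInto-nonempty l10 αl≤X βl≤Y = _ , here refl , target-edgesInto l10 αl≤X βl≤Y (here refl)
edgesInto-nonempty l01 αl≤X βl≤Y = _ , here refl , target-edgesInto l01 αl≤X βl≤Y (here refl)
edgesInto-nonempty l11 αl≤X βl≤Y = _ , here refl , target-edgesInto l11 αl≤X βl≤Y (here refl)

edgesInto-unique : ∀ l T → Unique (edgesInto l T)
edgesInto-unique l10 T = [] ∷ []
edgesInto-unique l01 T = [] ∷ []
edgesInto-unique l11 T = ((λ ()) ∷ []) ∷ [] ∷ []

length-edgesInto : ∀ l T → length (edgesInto l T) ≡ suc (α l * β l)
length-edgesInto l10 T = refl
length-edgesInto l01 T = refl
length-edgesInto l11 T = refl

β≤1 : ∀ l → β l ≤ 1
β≤1 l10 = z≤n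
β≤1 l01 = ≤-refl
β≤1 l11 = ≤-refl

α≤X+a : ∀ l X {a} → 1 ≤ a → α l ≤ X + a
α≤X+a l X 1≤a = ≤-trans (α≤1 l) (≤-trans 1≤a (m≤n+m _ X))

β≤sum : ∀ l {r} {k : Vec ℕ (suc r)} → IsComposition k → β l ≤ Vec.sum k
β≤sum l composition = ≤-trans (β≤1 l) (1≤sum composition)

Admissible : Letter × Vertex → Set
Admissible (l , (X , Y)) = α l ≤ X × β l ≤ Y

∈-edgesIntoAll⁻ : ∀ ps {e} → e ∈ edgesIntoAll ps → ∃ λ p → p ∈ ps × e ∈ uncurry edgesInto p
∈-edgesIntoAll⁻ ps e∈ = find (∈-concatMap⁻ (uncurry edgesInto) {xs = ps} e∈)

∈-edgesIntoAll⁺ : ∀ {ps p e} → p ∈ ps → e ∈ uncurry edgesInto p → e ∈ edgesIntoAll ps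
∈-edgesIntoAll⁺ p∈ e∈ = ∈-concatMap⁺ (uncurry edgesInto) (lose p∈ e∈)

module _ {ps : List (Letter × Vertex)} (admissible : All.All Admissible ps) where

  target-edgesIntoAll : ∀ {e} → e ∈ edgesIntoAll ps → target e ∈ map proj₂ ps
  target-edgesIntoAll e∈ with ∈-edgesIntoAll⁻ ps e∈
  ... | (l , (X , Y)) , p∈ , e∈′ = let αl≤X , βl≤Y = All.lookup admissible p∈ in
    subst (_∈ map proj₂ ps) (sym (target-edgesInto l αl≤X βl≤Y e∈′)) (∈-map⁺ proj₂ p∈)

  edgesIntoAll-cover : ∀ {t} → t ∈ map proj₂ ps → ∃ λ e → e ∈ edgesIntoAll ps × target e ≡ t
  edgesIntoAll-cover t∈ with ∈-map⁻ proj₂ t∈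
  ... | (l , (X , Y)) , p∈ , refl = let αl≤X , βl≤Y = All.lookup admissible p∈
                                        e , e∈ , te≡ = edgesInto-nonempty l αl≤X βl≤Y in
    e , ∈-edgesIntoAll⁺ p∈ e∈ , te≡

edgesIntoAll-unique : ∀ {ps} → All.All Admissible ps → Unique (map proj₂ ps) → Unique (edgesIntoAll ps)
edgesIntoAll-unique {[]} [] _ = []
edgesIntoAll-unique {(l , t) ∷ ps} ((αl≤X , βl≤Y) ∷ admissible) (t∉ts ∷ unique) =
  Unique.++⁺ (edgesInto-unique l t) (edgesIntoAll-unique admissible unique)
    λ (e∈first , e∈rest) → All.lookup t∉ts (target-edgesIntoAll admissible e∈rest)
                             (sym (target-edgesInto l αl≤X βl≤Y e∈first))

laterLetters-admissible : ∀ {r} X (w : Vec Letter r) {k} → IsComposition k → All.All Admissible (laterLetters X w k)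
laterLetters-admissible X [] {a ∷ []} (1≤a ∷ []) = (α≤X+a l10 X 1≤a , z≤n) ∷ []
laterLetters-admissible X (l ∷ w) {a ∷ k} (1≤a ∷ composition) =
  (α≤X+a l X 1≤a , β≤sum l composition) ∷ laterLetters-admissible (X + a) w composition

targets-laterLetters : ∀ {r} X (w : Vec Letter r) k → map proj₂ (laterLetters X w k) ≡ laterTerminals X k
targets-laterLetters X []      (a ∷ []) = refl
targets-laterLetters X (l ∷ w) (a ∷ k)  = cong ((X + a , Vec.sum k) ∷_) (targets-laterLetters (X + a) w k)

length-laterEdges : ∀ {r} X (w : Vec Letter r) k → length (laterEdges X w k) ≡ suc (r + wSize w)
length-laterEdges X [] (a ∷ []) = refl
length-laterEdges {suc r} X (l ∷ w) (a ∷ k) = begin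
  length (edgesInto l (X + a , Vec.sum k) ++ laterEdges (X + a) w k)
    ≡⟨ List.length-++ (edgesInto l (X + a , Vec.sum k)) ⟩
  length (edgesInto l (X + a , Vec.sum k)) + length (laterEdges (X + a) w k)
    ≡⟨ cong₂ _+_ (length-edgesInto l (X + a , Vec.sum k)) (length-laterEdges (X + a) w k) ⟩
  suc (α l * β l) + suc (r + wSize w)
    ≡⟨ cong suc (solve 3 (λ x r s → x :+ (con 1 :+ (r :+ s)) := con 1 :+ (r :+ (x :+ s)))
                  refl (α l * β l) r (wSize w)) ⟩
  suc (suc r + wSize (l ∷ w)) ∎
  where open ≡-Reasoning

module _ {r} (w : Vec Letter r) {k : Vec ℕ (suc r)} (composition : IsComposition k) where

  enteringLetters-admissible : All.All Admissible (enteringLetters w k)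
  enteringLetters-admissible = (z≤n , 1≤sum composition) ∷ laterLetters-admissible 0 w composition

  targets-enteringLetters : map proj₂ (enteringLetters w k) ≡ terminalsFrom 0 k
  targets-enteringLetters = cong ((0 , Vec.sum k) ∷_) (targets-laterLetters 0 w k)

  target-finalEdges : ∀ {e} → e ∈ finalEdges w k → target e ∈ terminalsFrom 0 k
  target-finalEdges {e} e∈ = subst (target e ∈_) targets-enteringLetters
    (target-edgesIntoAll enteringLetters-admissible e∈)

  finalEdges-cover : ∀ {t} → t ∈ terminalsFrom 0 k → ∃ λ e → e ∈ finalEdges w k × target e ≡ t
  finalEdges-cover {t} t∈ = edgesIntoAll-cover enteringLetters-admissible
    (subst (t ∈_) (sym targets-enteringLetters) t∈)

  finalEdges-unique : Unique (finalEdges w k)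
  finalEdges-unique = edgesIntoAll-unique enteringLetters-admissible
    (subst Unique (sym targets-enteringLetters) (terminalsFrom-unique 0 composition))

  length-finalEdges : length (finalEdges w k) ≡ suc (suc (r + wSize w))
  length-finalEdges = cong suc (length-laterEdges 0 w k)

-- The word of a face

letterOf : Bool → Bool → Letter
letterOf true  true  = l11
letterOf true  false = l10
letterOf false true  = l01
letterOf false false = l11 -- never used: a face enters every terminal

letterAt : (Edge → Bool) → Vertex → Letter
letterAt G (X , Y) = letterOf (G ((X ∸ 1 , Y) , true)) (G ((X , Y ∸ 1) , false))

laterWord : ∀ {r} → (Edge → Bool) → ℕ → Vec ℕ (suc r) → Vec Letter r
laterWord {zero}  G X (a ∷ []) = []
laterWord {suc r} G X (a ∷ k)  = letterAt G (X + a , Vec.sum k) ∷ laterWord G (X + a) k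

wordOf : ∀ {r} → (Edge → Bool) → Vec ℕ (suc r) → Vec Letter r
wordOf G k = laterWord G 0 k

HasEdgeInto : (Edge → Bool) → Vertex → Set
HasEdgeInto G t = ∃ λ e → T (G e) × target e ≡ t

EntersBy : (Edge → Bool) → Letter → Vertex → Set
EntersBy G l t = ∀ e → target e ≡ t → T (G e) ⇔ e ∈ edgesInto l t

target≡⇒ : ∀ {e X Y} → target e ≡ (X , Y) → e ≡ ((X ∸ 1 , Y) , true) ⊎ e ≡ ((X , Y ∸ 1) , false)
target≡⇒ {_ , true}  refl = inj₁ refl
target≡⇒ {_ , false} refl = inj₂ refl

entersBy-letterAt : ∀ G {t} → HasEdgeInto G t → EntersBy G (letterAt G t) t
entersBy-letterAt G {X , Y} (e₀ , Ge₀ , te₀≡) e te≡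
  with G ((X ∸ 1 , Y) , true) in gh | G ((X , Y ∸ 1) , false) in gv | target≡⇒ te≡
... | true  | true  | inj₁ refl = mk⇔ (λ _ → here refl) (λ _ → subst T (sym gh) _)
... | true  | true  | inj₂ refl = mk⇔ (λ _ → there (here refl)) (λ _ → subst T (sym gv) _)
... | true  | false | inj₁ refl = mk⇔ (λ _ → here refl) (λ _ → subst T (sym gh) _)
... | true  | false | inj₂ refl = mk⇔ (λ Ge → ⊥-elim (subst T gv Ge)) (λ { (here ()) })
... | false | true  | inj₁ refl = mk⇔ (λ Ge → ⊥-elim (subst T gh Ge)) (λ { (here ()) })
... | false | true  | inj₂ refl = mk⇔ (λ _ → here refl) (λ _ → subst T (sym gv) _)
... | false | false | _ with target≡⇒ te₀≡
...   | inj₁ refl = ⊥-elim (subst T gh Ge₀)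
...   | inj₂ refl = ⊥-elim (subst T gv Ge₀)

entersBy-single : ∀ G l t {e₁} → edgesInto l t ≡ e₁ ∷ [] → (∀ {e} → target e ≡ t → e ≡ e₁) →
  HasEdgeInto G t → EntersBy G l t
entersBy-single G l t {e₁} edges≡ into (e₀ , Ge₀ , te₀≡) e te≡ rewrite edges≡ | into te≡ =
  mk⇔ (λ _ → here refl) (λ _ → subst (T ∘ G) (into te₀≡) Ge₀)

edgeInto-first : ∀ {e Y} → target e ≡ (0 , Y) → e ≡ ((0 , Y ∸ 1) , false)
edgeInto-first {(0 , _) , false} refl = refl

edgeInto-last : ∀ {e X} → target e ≡ (X , 0) → e ≡ ((X ∸ 1 , 0) , true)
edgeInto-last {(_ , 0) , true} refl = refl

letterOf-αβ : ∀ l → letterOf (α l ≡ᵇ 1) (β l ≡ᵇ 1) ≡ l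
letterOf-αβ l10 = refl
letterOf-αβ l01 = refl
letterOf-αβ l11 = refl

letterAt-unique : ∀ G l {X Y} → 1 ≤ X → 1 ≤ Y → EntersBy G l (X , Y) → letterAt G (X , Y) ≡ l
letterAt-unique G l {suc X} {suc Y} _ _ enters =
  trans (cong₂ letterOf (bit refl (horizontal l)) (bit refl (vertical l))) (letterOf-αβ l)
  where
  open Equivalence
  bit : ∀ {e b} → target e ≡ (suc X , suc Y) → e ∈ edgesInto l (suc X , suc Y) ⇔ T b → G e ≡ b
  bit {e} te≡ e∈⇔b = T-ext (to e∈⇔b ∘ to (enters e te≡)) (from (enters e te≡) ∘ from e∈⇔b)
  horizontal : ∀ l′ → ((X , suc Y) , true) ∈ edgesInto l′ (suc X , suc Y) ⇔ T (α l′ ≡ᵇ 1)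
  horizontal l10 = mk⇔ (λ _ → _) (λ _ → here refl)
  horizontal l01 = mk⇔ (λ { (here ()) }) (λ ())
  horizontal l11 = mk⇔ (λ _ → _) (λ _ → here refl)
  vertical : ∀ l′ → ((suc X , Y) , false) ∈ edgesInto l′ (suc X , suc Y) ⇔ T (β l′ ≡ᵇ 1)
  vertical l10 = mk⇔ (λ { (here ()) }) (λ ())
  vertical l01 = mk⇔ (λ _ → _) (λ _ → here refl)
  vertical l11 = mk⇔ (λ _ → _) (λ _ → there (here refl))

edgesIntoAll-enteredBy : ∀ G {ps} → All.All Admissible ps → All.All (uncurry (EntersBy G)) ps →
  ∀ e → target e ∈ map proj₂ ps → T (G e) ⇔ e ∈ edgesIntoAll ps
edgesIntoAll-enteredBy G {ps} admissible enteredBy e te∈ = mk⇔ into fromBlock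
  where
  into : T (G e) → e ∈ edgesIntoAll ps
  into Ge with ∈-map⁻ proj₂ te∈
  ... | (l , t) , p∈ , te≡ = ∈-edgesIntoAll⁺ p∈ (Equivalence.to (All.lookup enteredBy p∈ e te≡) Ge)
  fromBlock : e ∈ edgesIntoAll ps → T (G e)
  fromBlock e∈ with ∈-edgesIntoAll⁻ ps e∈
  ... | (l , (X , Y)) , p∈ , e∈′ = let αl≤X , βl≤Y = All.lookup admissible p∈ in
    Equivalence.from (All.lookup enteredBy p∈ e (target-edgesInto l αl≤X βl≤Y e∈′)) e∈′

enteredBy-edgesIntoAll : ∀ G {ps} → All.All Admissible ps → Unique (map proj₂ ps) →
  (∀ e → target e ∈ map proj₂ ps → T (G e) ⇔ e ∈ edgesIntoAll ps) → All.All (uncurry (EntersBy G)) ps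
enteredBy-edgesIntoAll G {ps} admissible unique enters = All.tabulate λ {(l , t)} p∈ e te≡ →
  let te∈ = subst (_∈ map proj₂ ps) (sym te≡) (∈-map⁺ proj₂ p∈) in
  mk⇔ (inBlock p∈ te≡ ∘ Equivalence.to (enters e te∈))
      (Equivalence.from (enters e te∈) ∘ ∈-edgesIntoAll⁺ p∈)
  where
  inBlock : ∀ {l t e} → (l , t) ∈ ps → target e ≡ t → e ∈ edgesIntoAll ps → e ∈ edgesInto l t
  inBlock {e = e} p∈ te≡ e∈ with ∈-edgesIntoAll⁻ ps e∈
  ... | (l′ , (X , Y)) , p′∈ , e∈′ = let αl′≤X , βl′≤Y = All.lookup admissible p′∈ in
    subst (λ p → e ∈ uncurry edgesInto p)
      (Unique-map⇒injective proj₂ unique p′∈ p∈ (trans (sym (target-edgesInto l′ αl′≤X βl′≤Y e∈′)) te≡)) e∈′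

laterLetters-enteredBy : ∀ {r} G X (k : Vec ℕ (suc r)) → (∀ {t} → t ∈ laterTerminals X k → HasEdgeInto G t) →
  All.All (uncurry (EntersBy G)) (laterLetters X (laterWord G X k) k)
laterLetters-enteredBy {zero}  G X (a ∷ []) hasEdge =
  entersBy-single G l10 _ refl edgeInto-last (hasEdge (here refl)) ∷ []
laterLetters-enteredBy {suc r} G X (a ∷ k)  hasEdge =
  entersBy-letterAt G (hasEdge (here refl)) ∷ laterLetters-enteredBy G (X + a) k (hasEdge ∘ there)

laterWord-unique : ∀ {r} G X (w : Vec Letter r) {k} → IsComposition k →
  All.All (uncurry (EntersBy G)) (laterLetters X w k) → laterWord G X k ≡ w
laterWord-unique G X []      {a ∷ []} _ _ = refl
laterWord-unique G X (l ∷ w) {a ∷ k}  (1≤a ∷ composition) (enteredBy ∷ rest) =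
  cong₂ _∷_ (letterAt-unique G l (≤-trans 1≤a (m≤n+m a X)) (1≤sum composition) enteredBy)
            (laterWord-unique G (X + a) w composition rest)

module _ (G : Edge → Bool) {r} {k : Vec ℕ (suc r)} (composition : IsComposition k) where

  finalEdges-wordOf : (∀ {t} → t ∈ terminalsFrom 0 k → HasEdgeInto G t) →
    ∀ e → target e ∈ terminalsFrom 0 k → T (G e) ⇔ e ∈ finalEdges (wordOf G k) k
  finalEdges-wordOf hasEdge e te∈ = edgesIntoAll-enteredBy G (enteringLetters-admissible (wordOf G k) composition)
    (entersBy-single G l01 _ refl edgeInto-first (hasEdge (here refl))
      ∷ laterLetters-enteredBy G 0 k (hasEdge ∘ there))
    e (subst (target e ∈_) (sym (targets-enteringLetters (wordOf G k) composition)) te∈)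

  wordOf-unique : ∀ w → (∀ e → target e ∈ terminalsFrom 0 k → T (G e) ⇔ e ∈ finalEdges w k) → wordOf G k ≡ w
  wordOf-unique w enters = laterWord-unique G 0 w composition (All.tail
    (enteredBy-edgesIntoAll G (enteringLetters-admissible w composition)
      (subst Unique (sym (targets-enteringLetters w composition)) (terminalsFrom-unique 0 composition))
      (λ e te∈ → enters e (subst (target e ∈_) (targets-enteringLetters w composition) te∈))))

-- Splitting off the top level of a family of paths

initSteps : List Bool → List Bool
initSteps []           = []
initSteps (_ ∷ [])     = []
initSteps (x ∷ y ∷ ys) = x ∷ initSteps (y ∷ ys)

lastStep : List Bool → Bool
lastStep []           = true -- junk value
lastStep (x ∷ [])     = x
lastStep (_ ∷ y ∷ ys) = lastStep (y ∷ ys)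

initSteps-∷ʳ-lastStep : ∀ p {n} → length p ≡ suc n → p ≡ initSteps p List.∷ʳ lastStep p
initSteps-∷ʳ-lastStep (x ∷ [])     _ = refl
initSteps-∷ʳ-lastStep (x ∷ y ∷ ys) _ = cong (x ∷_) (initSteps-∷ʳ-lastStep (y ∷ ys) refl)

initSteps-∷ʳ : ∀ p d → initSteps (p List.∷ʳ d) ≡ p
initSteps-∷ʳ []          d = refl
initSteps-∷ʳ (x ∷ [])    d = refl
initSteps-∷ʳ (x ∷ y ∷ p) d = cong (x ∷_) (initSteps-∷ʳ (y ∷ p) d)

lastStep-∷ʳ : ∀ p d → lastStep (p List.∷ʳ d) ≡ d
lastStep-∷ʳ []          d = refl
lastStep-∷ʳ (x ∷ [])    d = refl
lastStep-∷ʳ (x ∷ y ∷ p) d = lastStep-∷ʳ (y ∷ p) d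

lastEdge : List Bool → Edge
lastEdge p = endpoint origin (initSteps p) , lastStep p

length-∷ʳ : ∀ (p : List Bool) d → length (p List.∷ʳ d) ≡ suc (length p)
length-∷ʳ p d = trans (List.length-++ p) (+-comm _ 1)

lastEdge-∷ʳ : ∀ p d → lastEdge (p List.∷ʳ d) ≡ (endpoint origin p , d)
lastEdge-∷ʳ p d = cong₂ (λ q d′ → (endpoint origin q , d′)) (initSteps-∷ʳ p d) (lastStep-∷ʳ p d)

module _ {n′ : ℕ} (p : List Bool) (length≡ : length p ≡ suc n′) where

  private
    p≡ = initSteps-∷ʳ-lastStep p length≡

  length-initSteps : length (initSteps p) ≡ n′
  length-initSteps = suc-injective (trans (sym (length-∷ʳ (initSteps p) (lastStep p)))
    (trans (cong length (sym p≡)) length≡))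

  target-lastEdge : target (lastEdge p) ≡ endpoint origin p
  target-lastEdge = trans (sym (endpoint-∷ʳ origin (initSteps p) (lastStep p))) (cong (endpoint origin) (sym p≡))

  ∈-pathVertices-split⁻ : ∀ {v} → v ∈ pathVerticesFrom origin p →
    v ∈ pathVerticesFrom origin (initSteps p) ⊎ v ≡ endpoint origin p
  ∈-pathVertices-split⁻ {v} v∈ = Sum.map₂ (λ v≡ → trans v≡ target-lastEdge)
    (∈-pathVertices-∷ʳ⁻ origin (initSteps p) (lastStep p) (subst (λ q → v ∈ pathVerticesFrom origin q) p≡ v∈))

  ∈-pathVertices-init⇒ : ∀ {v} → v ∈ pathVerticesFrom origin (initSteps p) → v ∈ pathVerticesFrom origin p
  ∈-pathVertices-init⇒ {v} v∈ = subst (λ q → v ∈ pathVerticesFrom origin q) (sym p≡)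
    (∈-pathVertices-∷ʳ⁺ origin (initSteps p) (lastStep p) v∈)

  ∈-pathEdges-split⁻ : ∀ {e} → e ∈ pathEdgesFrom origin p → e ∈ pathEdgesFrom origin (initSteps p) ⊎ e ≡ lastEdge p
  ∈-pathEdges-split⁻ {e} e∈ =
    ∈-pathEdges-∷ʳ⁻ origin (initSteps p) (lastStep p) (subst (λ q → e ∈ pathEdgesFrom origin q) p≡ e∈)

  ∈-pathEdges-init⇒ : ∀ {e} → e ∈ pathEdgesFrom origin (initSteps p) → e ∈ pathEdgesFrom origin p
  ∈-pathEdges-init⇒ {e} e∈ = subst (λ q → e ∈ pathEdgesFrom origin q) (sym p≡)
    (∈-pathEdges-∷ʳ⁺ origin (initSteps p) (lastStep p) e∈)

  lastEdge-∈-pathEdges : lastEdge p ∈ pathEdgesFrom origin p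
  lastEdge-∈-pathEdges = subst (λ q → lastEdge p ∈ pathEdgesFrom origin q) (sym p≡)
    (lastEdge-∈-pathEdges-∷ʳ origin (initSteps p) (lastStep p))

  level-initSteps : ∀ {v} → v ∈ pathVerticesFrom origin (initSteps p) → level v ≤ n′
  level-initSteps {v} v∈ = subst (level v ≤_) length-initSteps (∈-pathVertices⇒level≤ origin (initSteps p) v∈)

  level-target-initSteps : ∀ {e} → e ∈ pathEdgesFrom origin (initSteps p) → level (target e) ≤ n′
  level-target-initSteps e∈ = level-initSteps (proj₂ (∈-pathEdges⇒∈-pathVertices origin (initSteps p) e∈))

  level-endpoint-origin : level (endpoint origin p) ≡ suc n′
  level-endpoint-origin = trans (level-endpoint origin p) length≡

module _ {n : ℕ} {S : List (List Bool)} (lengths : ∀ {p} → p ∈ S → length p ≡ n) where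

  memberV-unionGraph : ∀ v → memberV n (unionGraph n S) v ≡ onSomePathV S v
  memberV-unionGraph v = T-ext
    (λ h → let _ , p∈ , v∈ = memberV-unionGraph⁻ n S v h in onSomePathV⁺ p∈ v∈)
    (λ h → let _ , p∈ , v∈ = onSomePathV⁻ S v h in memberV-unionGraph⁺ (lengths p∈) p∈ v∈)

  level-onSomePathV : ∀ v → T (onSomePathV S v) → level v ≤ n
  level-onSomePathV v h = let p , p∈ , v∈ = onSomePathV⁻ S v h in
    subst (level v ≤_) (lengths p∈) (∈-pathVertices⇒level≤ origin p v∈)

  level-onSomePathE : ∀ e → T (onSomePathE S e) → level (target e) ≤ n
  level-onSomePathE e h = let p , p∈ , e∈ = onSomePathE⁻ S e h in
    subst (level (target e) ≤_) (lengths p∈) (∈-pathVertices⇒level≤ origin p (proj₂ (∈-pathEdges⇒∈-pathVertices origin p e∈)))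

  memberE-unionGraph : ∀ e → memberE n (unionGraph n S) e ≡ onSomePathE S e
  memberE-unionGraph (u , d) = T-ext
    (λ h → let _ , p∈ , e∈ = memberE-unionGraph⁻ n S u d h in onSomePathE⁺ p∈ e∈)
    (λ h → let _ , p∈ , e∈ = onSomePathE⁻ S (u , d) h in memberE-unionGraph⁺ (lengths p∈) p∈ e∈)

any-==V-cong : ∀ {ts ts′} → (∀ {t} → t ∈ ts → t ∈ ts′) → (∀ {t} → t ∈ ts′ → t ∈ ts) →
  ∀ v → any (v ==V_) ts ≡ any (v ==V_) ts′
any-==V-cong {ts} {ts′} ts⊆ts′ ts′⊆ts v =
  T-ext (any-==V⁺ ∘ ts⊆ts′ ∘ any-==V⁻ {v} ts) (any-==V⁺ ∘ ts′⊆ts ∘ any-==V⁻ {v} ts′)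

any-==E-cong : ∀ {E E′} → (∀ {e} → e ∈ E → e ∈ E′) → (∀ {e} → e ∈ E′ → e ∈ E) →
  ∀ e → any (e ==E_) E ≡ any (e ==E_) E′
any-==E-cong {E} {E′} E⊆E′ E′⊆E e =
  T-ext (any-==E⁺ ∘ E⊆E′ ∘ any-==E⁻ {e} E) (any-==E⁺ ∘ E′⊆E ∘ any-==E⁻ {e} E′)

below : ℕ → Subgraph → Subgraph
below n′ γ = encode n′ (λ v → memberV (suc n′) γ v ∧ (level v ≤ᵇ n′))
                       (λ e → memberE (suc n′) γ e ∧ (level (target e) ≤ᵇ n′))

attach : ℕ → Subgraph → List Vertex → List Edge → Subgraph
attach n′ γ′ ts E = encode (suc n′) (λ v → memberV n′ γ′ v ∨ any (v ==V_) ts)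
                                    (λ e → memberE n′ γ′ e ∨ any (e ==E_) E)

attach-cong : ∀ n′ γ′ {ts ts′ E E′} → (∀ {t} → t ∈ ts → t ∈ ts′) → (∀ {t} → t ∈ ts′ → t ∈ ts) →
  (∀ {e} → e ∈ E → e ∈ E′) → (∀ {e} → e ∈ E′ → e ∈ E) → attach n′ γ′ ts E ≡ attach n′ γ′ ts′ E′
attach-cong n′ γ′ ts⊆ ts⊇ E⊆ E⊇ = encode-cong (suc n′)
  (λ {v} _ → cong (memberV n′ γ′ v ∨_) (any-==V-cong ts⊆ ts⊇ v))
  (λ {u} d _ → cong (memberE n′ γ′ (u , d) ∨_) (any-==E-cong E⊆ E⊇ (u , d)))

module _ {n′ : ℕ} {S : List (List Bool)} (lengths : ∀ {p} → p ∈ S → length p ≡ suc n′) where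

  private
    S′ = map initSteps S

    lengths′ : ∀ {q} → q ∈ S′ → length q ≡ n′
    lengths′ q∈ with ∈-map⁻ initSteps q∈
    ... | p , p∈ , refl = length-initSteps p (lengths p∈)

    onInit⇒ : ∀ v → T (onSomePathV S′ v) → T (onSomePathV S v)
    onInit⇒ v h with onSomePathV⁻ S′ v h
    ... | q , q∈ , v∈ with ∈-map⁻ initSteps q∈
    ...   | p , p∈ , refl = onSomePathV⁺ p∈ (∈-pathVertices-init⇒ p (lengths p∈) v∈)

    onInitE⇒ : ∀ e → T (onSomePathE S′ e) → T (onSomePathE S e)
    onInitE⇒ e h with onSomePathE⁻ S′ e h
    ... | q , q∈ , e∈ with ∈-map⁻ initSteps q∈
    ...   | p , p∈ , refl = onSomePathE⁺ p∈ (∈-pathEdges-init⇒ p (lengths p∈) e∈)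

  onSomePathV-split : ∀ v → onSomePathV S v ≡ onSomePathV S′ v ∨ any (v ==V_) (map (endpoint origin) S)
  onSomePathV-split v = T-ext split⇒ ([ onInit⇒ v , atEnd ]′ ∘ T-∨⁻ (onSomePathV S′ v))
    where
    split⇒ : T (onSomePathV S v) → T (onSomePathV S′ v ∨ any (v ==V_) (map (endpoint origin) S))
    split⇒ h with onSomePathV⁻ S v h
    ... | p , p∈ , v∈ = Equivalence.from T-∨ (Sum.map (onSomePathV⁺ (∈-map⁺ initSteps p∈))
      (λ { refl → any-==V⁺ (∈-map⁺ (endpoint origin) p∈) }) (∈-pathVertices-split⁻ p (lengths p∈) v∈))
    atEnd : T (any (v ==V_) (map (endpoint origin) S)) → T (onSomePathV S v)
    atEnd h with ∈-map⁻ (endpoint origin) (any-==V⁻ {v} (map (endpoint origin) S) h)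
    ... | p , p∈ , refl = onSomePathV⁺ {S} p∈ (endpoint-∈-pathVertices origin p)

  onSomePathE-split : ∀ e → onSomePathE S e ≡ onSomePathE S′ e ∨ any (e ==E_) (map lastEdge S)
  onSomePathE-split e = T-ext split⇒ ([ onInitE⇒ e , atEnd ]′ ∘ T-∨⁻ (onSomePathE S′ e))
    where
    split⇒ : T (onSomePathE S e) → T (onSomePathE S′ e ∨ any (e ==E_) (map lastEdge S))
    split⇒ h with onSomePathE⁻ S e h
    ... | p , p∈ , e∈ = Equivalence.from T-∨ (Sum.map (onSomePathE⁺ (∈-map⁺ initSteps p∈))
      (λ { refl → any-==E⁺ (∈-map⁺ lastEdge p∈) }) (∈-pathEdges-split⁻ p (lengths p∈) e∈))
    atEnd : T (any (e ==E_) (map lastEdge S)) → T (onSomePathE S e)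
    atEnd h with ∈-map⁻ lastEdge (any-==E⁻ {e} (map lastEdge S) h)
    ... | p , p∈ , refl = onSomePathE⁺ {S} p∈ (lastEdge-∈-pathEdges p (lengths p∈))

  below-unionGraph : below n′ (unionGraph (suc n′) S) ≡ unionGraph n′ S′
  below-unionGraph = encode-cong n′
    (λ {v} _ → trans (cong (_∧ (level v ≤ᵇ n′)) (memberV-unionGraph lengths v)) (T-ext (belowV⇒ v) (belowV⇐ v)))
    (λ {u} d _ → trans (cong (_∧ (level (target (u , d)) ≤ᵇ n′)) (memberE-unionGraph lengths (u , d)))
                       (T-ext (belowE⇒ (u , d)) (belowE⇐ (u , d))))
    where
    belowV⇒ : ∀ v → T (onSomePathV S v ∧ (level v ≤ᵇ n′)) → T (onSomePathV S′ v)
    belowV⇒ v h with T-∧⁻ (onSomePathV S v) h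
    ... | onS , low with T-∨⁻ (onSomePathV S′ v) (subst T (onSomePathV-split v) onS)
    ...   | inj₁ onS′ = onS′
    ...   | inj₂ atEnd with ∈-map⁻ (endpoint origin) (any-==V⁻ {v} (map (endpoint origin) S) atEnd)
    ...     | p , p∈ , refl = ⊥-elim (1+n≰n (subst (_≤ n′) (level-endpoint-origin p (lengths p∈)) (≤ᵇ⇒≤ _ _ low)))
    belowV⇐ : ∀ v → T (onSomePathV S′ v) → T (onSomePathV S v ∧ (level v ≤ᵇ n′))
    belowV⇐ v h = Equivalence.from T-∧ (onInit⇒ v h , ≤⇒≤ᵇ (level-onSomePathV lengths′ v h))
    belowE⇒ : ∀ e → T (onSomePathE S e ∧ (level (target e) ≤ᵇ n′)) → T (onSomePathE S′ e)
    belowE⇒ e h with T-∧⁻ (onSomePathE S e) h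
    ... | onS , low with T-∨⁻ (onSomePathE S′ e) (subst T (onSomePathE-split e) onS)
    ...   | inj₁ onS′ = onS′
    ...   | inj₂ atEnd with ∈-map⁻ lastEdge (any-==E⁻ {e} (map lastEdge S) atEnd)
    ...     | p , p∈ , refl = ⊥-elim (1+n≰n (subst (_≤ n′)
                                (trans (cong level (target-lastEdge p (lengths p∈))) (level-endpoint-origin p (lengths p∈)))
                                (≤ᵇ⇒≤ _ _ low)))
    belowE⇐ : ∀ e → T (onSomePathE S′ e) → T (onSomePathE S e ∧ (level (target e) ≤ᵇ n′))
    belowE⇐ e h = Equivalence.from T-∧ (onInitE⇒ e h , ≤⇒≤ᵇ (level-onSomePathE lengths′ e h))

  unionGraph-split : unionGraph (suc n′) S ≡ attach n′ (unionGraph n′ S′) (map (endpoint origin) S) (map lastEdge S)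
  unionGraph-split = encode-cong (suc n′)
    (λ {v} _ → trans (onSomePathV-split v) (cong (_∨ any (v ==V_) (map (endpoint origin) S)) (sym (memberV-unionGraph lengths′ v))))
    (λ {u} d _ → trans (onSomePathE-split (u , d))
                   (cong (_∨ any ((u , d) ==E_) (map lastEdge S)) (sym (memberE-unionGraph lengths′ (u , d)))))

-- Dimension of a union of paths with a new top level attached

vertices≤edges+1 : ∀ n S → (∀ {p} → p ∈ S → length p ≡ n) →
  length (filterᵇ (onSomePathV S) (boxVertices n)) ≤ suc (length (filterᵇ (onSomePathE S) (boxEdges n)))
vertices≤edges+1 n S lengths = subst (length (filterᵇ (onSomePathV S) (boxVertices n)) ≤_) (cong suc (List.length-map target edges))
  (length-≤-⊆ (Unique-filterᵇ (onSomePathV S) (boxVertices-unique n)) origin-or-target)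
  where
  edges = filterᵇ (onSomePathE S) (boxEdges n)
  origin-or-target : ∀ {v} → v ∈ filterᵇ (onSomePathV S) (boxVertices n) → v ∈ origin ∷ map target edges
  origin-or-target {v} v∈ with onSomePathV⁻ S v (proj₂ (∈-filterᵇ⁻ (onSomePathV S) (boxVertices n) v∈)) | v ≟V origin
  ... | _ | yes refl = here refl
  ... | p , p∈ , v∈p | no v≢origin = let e , e∈ , te≡v = ∈-pathVertices⇒incoming origin p v∈p v≢origin in
    there (subst (_∈ map target edges) te≡v (∈-map⁺ target (∈-filterᵇ⁺ (onSomePathE S)
      (∈-boxEdges⁺ n (proj₂ e) (level≤⇒inBox (proj₁ e) (subst (level (proj₁ e) ≤_) (lengths p∈)
        (∈-pathVertices⇒level≤ origin p (proj₁ (∈-pathEdges⇒∈-pathVertices origin p e∈))))))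
      (onSomePathE⁺ p∈ e∈))))

-- dim is #E + 1 ∸ #V, so adding vertices and edges shifts it only when #V ≤ #E + 1.
private
  dimension-shift : ∀ E V c x → V ≤ E + 1 → (E + (c + x) + 1) ∸ (V + c) ≡ ((E + 1) ∸ V) + x
  dimension-shift E V c x V≤E+1 = begin
    (E + (c + x) + 1) ∸ (V + c) ≡⟨ cong₂ _∸_ (solve 3 (λ E c x → E :+ (c :+ x) :+ con 1 := c :+ (E :+ con 1 :+ x)) refl E c x) (+-comm V c) ⟩
    (c + (E + 1 + x)) ∸ (c + V) ≡⟨ [m+n]∸[m+o]≡n∸o c (E + 1 + x) V ⟩
    (E + 1 + x) ∸ V             ≡⟨ +-∸-comm x V≤E+1 ⟩
    ((E + 1) ∸ V) + x           ∎
    where open ≡-Reasoning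

module _ (n′ : ℕ) (S : List (List Bool)) (lengths : ∀ {p} → p ∈ S → length p ≡ n′) where

  count-attach-vertices : ∀ {ts} → Unique ts → (∀ {t} → t ∈ ts → level t ≡ suc n′) →
    length (filterᵇ (λ v → memberV n′ (unionGraph n′ S) v ∨ any (v ==V_) ts) (boxVertices (suc n′)))
    ≡ length (filterᵇ (onSomePathV S) (boxVertices n′)) + length ts
  count-attach-vertices {ts} uniqueTs level-ts =
    trans (length-filterᵇ-∨ (memberV n′ (unionGraph n′ S)) (λ v → any (v ==V_) ts) (boxVertices (suc n′)) disjoint)
          (cong₂ _+_ old new)
    where
    disjoint : ∀ v → T (memberV n′ (unionGraph n′ S) v) → T (any (v ==V_) ts) → ⊥
    disjoint v old new = 1+n≰n (subst (_≤ n′) (level-ts (any-==V⁻ {v} ts new))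
      (level-onSomePathV lengths v (subst T (memberV-unionGraph lengths v) old)))
    old : length (filterᵇ (memberV n′ (unionGraph n′ S)) (boxVertices (suc n′)))
          ≡ length (filterᵇ (onSomePathV S) (boxVertices n′))
    old = length-filterᵇ≡ (memberV n′ (unionGraph n′ S)) (boxVertices-unique (suc n′))
      (Unique-filterᵇ (onSomePathV S) (boxVertices-unique n′))
      (λ {v} v∈ → let v∈box , onS = ∈-filterᵇ⁻ (onSomePathV S) (boxVertices n′) v∈ in
        ∈-boxVertices⁺ (suc n′) (inBox-mono v (n≤1+n n′) (∈-boxVertices⁻ n′ v∈box)) ,
        subst T (sym (memberV-unionGraph lengths v)) onS)
      (λ {v} _ h → let v∈box , onS = memberV-encode⁻ {n′} {onSomePathV S} {onSomePathE S} v h in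
        ∈-filterᵇ⁺ (onSomePathV S) (∈-boxVertices⁺ n′ v∈box) onS)
    new : length (filterᵇ (λ v → any (v ==V_) ts) (boxVertices (suc n′))) ≡ length ts
    new = length-filterᵇ≡ _ (boxVertices-unique (suc n′)) uniqueTs
      (λ {t} t∈ → ∈-boxVertices⁺ (suc n′) (level≤⇒inBox t (≤-reflexive (level-ts t∈))) , any-==V⁺ t∈)
      (λ {v} _ h → any-==V⁻ {v} ts h)

  count-attach-edges : ∀ {E} → Unique E → (∀ {e} → e ∈ E → level (target e) ≡ suc n′) →
    length (filterᵇ (λ e → memberE n′ (unionGraph n′ S) e ∨ any (e ==E_) E) (boxEdges (suc n′)))
    ≡ length (filterᵇ (onSomePathE S) (boxEdges n′)) + length E
  count-attach-edges {E} uniqueE level-E =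
    trans (length-filterᵇ-∨ (memberE n′ (unionGraph n′ S)) (λ e → any (e ==E_) E) (boxEdges (suc n′)) disjoint)
          (cong₂ _+_ old new)
    where
    disjoint : ∀ e → T (memberE n′ (unionGraph n′ S) e) → T (any (e ==E_) E) → ⊥
    disjoint e old new = 1+n≰n (subst (_≤ n′) (level-E (any-==E⁻ {e} E new))
      (level-onSomePathE lengths e (subst T (memberE-unionGraph lengths e) old)))
    old : length (filterᵇ (memberE n′ (unionGraph n′ S)) (boxEdges (suc n′)))
          ≡ length (filterᵇ (onSomePathE S) (boxEdges n′))
    old = length-filterᵇ≡ (memberE n′ (unionGraph n′ S)) (boxEdges-unique (suc n′))
      (Unique-filterᵇ (onSomePathE S) (boxEdges-unique n′))
      (λ {(u , d)} e∈ → let e∈box , onS = ∈-filterᵇ⁻ (onSomePathE S) (boxEdges n′) e∈ in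
        ∈-boxEdges⁺ (suc n′) d (inBox-mono u (n≤1+n n′) (∈-boxEdges⁻ n′ e∈box)) ,
        subst T (sym (memberE-unionGraph lengths (u , d))) onS)
      (λ {(u , d)} _ h → let u∈box , onS = memberE-encode⁻ {n′} {onSomePathV S} {onSomePathE S} u d h in
        ∈-filterᵇ⁺ (onSomePathE S) (∈-boxEdges⁺ n′ d u∈box) onS)
    new : length (filterᵇ (λ e → any (e ==E_) E) (boxEdges (suc n′))) ≡ length E
    new = length-filterᵇ≡ _ (boxEdges-unique (suc n′)) uniqueE
      (λ {(u , d)} e∈ → ∈-boxEdges⁺ (suc n′) d (level≤⇒inBox u (≤-trans (n≤1+n (level u))
        (≤-reflexive (trans (sym (level-step u d)) (level-E e∈))))) , any-==E⁺ e∈)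
      (λ {e} _ h → any-==E⁻ {e} E h)

  dim-attach : ∀ {ts E} x → Unique ts → Unique E → (∀ {t} → t ∈ ts → level t ≡ suc n′) →
    (∀ {e} → e ∈ E → level (target e) ≡ suc n′) → length E ≡ length ts + x →
    dim (attach n′ (unionGraph n′ S) ts E) ≡ dim (unionGraph n′ S) + x
  dim-attach {ts} {E} x uniqueTs uniqueE level-ts level-E length≡ = begin
    dim (attach n′ (unionGraph n′ S) ts E)
      ≡⟨ dim-encode {suc n′} {λ v → memberV n′ (unionGraph n′ S) v ∨ any (v ==V_) ts}
                             {λ e → memberE n′ (unionGraph n′ S) e ∨ any (e ==E_) E} ⟩
    (length (filterᵇ (λ e → memberE n′ (unionGraph n′ S) e ∨ any (e ==E_) E) (boxEdges (suc n′))) + 1)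
      ∸ length (filterᵇ (λ v → memberV n′ (unionGraph n′ S) v ∨ any (v ==V_) ts) (boxVertices (suc n′)))
      ≡⟨ cong₂ (λ e v → (e + 1) ∸ v) (trans (count-attach-edges uniqueE level-E) (cong (E′ +_) length≡))
                                      (count-attach-vertices uniqueTs level-ts) ⟩
    (E′ + (length ts + x) + 1) ∸ (V′ + length ts)
      ≡⟨ dimension-shift E′ V′ (length ts) x (subst (V′ ≤_) (+-comm 1 E′) (vertices≤edges+1 n′ S lengths)) ⟩
    ((E′ + 1) ∸ V′) + x
      ≡⟨ cong (_+ x) (sym (dim-encode {n′} {onSomePathV S} {onSomePathE S})) ⟩
    dim (unionGraph n′ S) + x ∎
    where
    open ≡-Reasoning
    V′ = length (filterᵇ (onSomePathV S) (boxVertices n′))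
    E′ = length (filterᵇ (onSomePathE S) (boxEdges n′))

  memberE-attach-top : ∀ {ts E} e → level (target e) ≡ suc n′ →
    T (memberE (suc n′) (attach n′ (unionGraph n′ S) ts E) e) ⇔ e ∈ E
  memberE-attach-top {ts} {E} (u , d) level≡ = mk⇔
    (λ h → [ (λ old → ⊥-elim (1+n≰n (subst (_≤ n′) level≡ (level-onSomePathE lengths (u , d)
                            (subst T (memberE-unionGraph lengths (u , d)) old)))))
           , any-==E⁻ {u , d} E ]′ (T-∨⁻ (memberE n′ (unionGraph n′ S) (u , d)) (subst T bit≡ h)))
    (λ e∈ → subst T (sym bit≡) (Equivalence.from T-∨ (inj₂ (any-==E⁺ e∈))))
    where
    bit≡ : memberE (suc n′) (attach n′ (unionGraph n′ S) ts E) (u , d) ≡ memberE n′ (unionGraph n′ S) (u , d) ∨ any ((u , d) ==E_) E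
    bit≡ = memberE-encode {suc n′} {λ v → memberV n′ (unionGraph n′ S) v ∨ any (v ==V_) ts}
                          {λ e → memberE n′ (unionGraph n′ S) e ∨ any (e ==E_) E} d
      (level≤⇒inBox u (≤-trans (n≤1+n (level u)) (≤-reflexive (trans (sym (level-step u d)) level≡))))

-- Faces with a given word and faces of the reduced ladder

_≟L_ : (l l′ : Letter) → Dec (l ≡ l′)
l10 ≟L l10 = yes refl
l10 ≟L l01 = no λ ()
l10 ≟L l11 = no λ ()
l01 ≟L l10 = no λ ()
l01 ≟L l01 = yes refl
l01 ≟L l11 = no λ ()
l11 ≟L l10 = no λ ()
l11 ≟L l01 = no λ ()
l11 ≟L l11 = yes refl

_≟W_ : ∀ {r} (v w : Vec Letter r) → Dec (v ≡ w)
_≟W_ = Vec.≡-dec _≟L_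

faceWord : ∀ {r} → Vec ℕ (suc r) → Subgraph → Vec Letter r
faceWord k γ = wordOf (memberE (sum (toList k)) γ) k

module Reduction {r} {k : Vec ℕ (suc r)} (composition : IsComposition k) (w : Vec Letter r) where

  M : List ℕ
  M = reducedSequence w k

  -- The height of Γ_k is taken to be suc n′ rather than sum m, so that the boxes
  -- of Γ_k and of the reduced ladder match definitionally; sum-k relates the two.
  n′ n : ℕ
  n′ = sum M
  n  = suc n′

  private
    m  = toList k
    FE = finalEdges w k

  sum-k : sum m ≡ n
  sum-k = trans (sum-toList k)
    (sym (trans (cong suc (sum-reducedSequence w composition)) (m+[n∸m]≡n (1≤sum composition))))

  level-terminal : ∀ {t} → t ∈ terminalsFrom 0 k → level t ≡ n
  level-terminal t∈ = trans (level-terminalsFrom 0 k t∈) (trans (sym (sum-toList k)) sum-k)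

  level-tail : ∀ {u} → IsTail u FE → level u ≡ n′
  level-tail {u} (d , e∈) = suc-injective (trans (sym (level-step u d)) (level-terminal (target-finalEdges w composition e∈)))

  private
    terminal⇒∈ : ∀ {t} → t ∈ terminals m → t ∈ terminalsFrom 0 k
    terminal⇒∈ {t} = subst (t ∈_) (shiftedTerminals-toList 0 k)

    ∈⇒terminal : ∀ {t} → t ∈ terminalsFrom 0 k → t ∈ terminals m
    ∈⇒terminal {t} = subst (t ∈_) (sym (shiftedTerminals-toList 0 k))

  spanning-k : ∀ {S} → (∀ {p} → p ∈ S → length p ≡ n × endpoint origin p ∈ terminalsFrom 0 k) →
    (∀ {t} → t ∈ terminalsFrom 0 k → ∃ λ p → p ∈ S × endpoint origin p ≡ t) → Spanning m S
  spanning-k positive reach = spanning⁺ m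
    (λ p∈ → let length≡ , end∈ = positive p∈ in trans length≡ (sym sum-k) , ∈⇒isTerminal k end∈)
    (reach ∘ terminal⇒∈)

  spanning-M : ∀ {S′} → (∀ {p′} → p′ ∈ S′ → length p′ ≡ n′ × IsTail (endpoint origin p′) FE) →
    (∀ {u} → IsTail u FE → ∃ λ p′ → p′ ∈ S′ × endpoint origin p′ ≡ u) → Spanning M S′
  spanning-M positive reach = spanning⁺ M
    (λ p∈ → let length≡ , tail = positive p∈ in length≡ , isTerminal-reducedSequence⁺ w composition _ tail)
    (λ {u} u∈ → reach (isTerminal-reducedSequence⁻ w composition u (any-==V⁺ u∈)))

  reach-k : ∀ {S} → Spanning m S → ∀ {t} → t ∈ terminalsFrom 0 k → ∃ λ p → p ∈ S × endpoint origin p ≡ t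
  reach-k spanning t∈ = spanning-reach m spanning (∈⇒terminal t∈) (trans (level-terminal t∈) (sym sum-k))

  reach-M : ∀ {S′} → Spanning M S′ → ∀ {u} → IsTail u FE → ∃ λ p′ → p′ ∈ S′ × endpoint origin p′ ≡ u
  reach-M spanning {u} tail =
    spanning-reach M spanning (any-==V⁻ {u} _ (isTerminal-reducedSequence⁺ w composition u tail)) (level-tail tail)

  facesPos-k⁻ : ∀ {γ} → γ ∈ facesPos m → ∃ λ S → Spanning m S × γ ≡ unionGraph n S
  facesPos-k⁻ γ∈ = let S , spanning , γ≡ = facesPos⁻ m γ∈ in
    S , spanning , trans γ≡ (cong (λ N → unionGraph N S) sum-k)

  facesPos-k⁺ : ∀ {S} → Spanning m S → unionGraph n S ∈ facesPos m
  facesPos-k⁺ {S} spanning = subst (λ N → unionGraph N S ∈ facesPos m) sum-k (facesPos⁺ m spanning)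

  faceWord≡ : ∀ γ → faceWord k γ ≡ wordOf (memberE n γ) k
  faceWord≡ γ = cong (λ N → wordOf (memberE N γ) k) sum-k

  extend : Subgraph → Subgraph
  extend γ′ = attach n′ γ′ (terminalsFrom 0 k) FE

  restrict : Subgraph → Subgraph
  restrict = below n′

  module Extension {S′} (spanning : Spanning M S′) where

    lengths′ : ∀ {p′} → p′ ∈ S′ → length p′ ≡ n′
    lengths′ = proj₁ ∘ Spanning.positive spanning

    extensions : List (List Bool)
    extensions = concatMap
      (λ p′ → map (λ e → p′ List.∷ʳ proj₂ e) (filterᵇ (λ e → proj₁ e ==V endpoint origin p′) FE)) S′

    ∈-extensions⁻ : ∀ {q} → q ∈ extensions →
      ∃₂ λ p′ d → p′ ∈ S′ × (endpoint origin p′ , d) ∈ FE × q ≡ p′ List.∷ʳ d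
    ∈-extensions⁻ q∈ with find (∈-concatMap⁻ _ {xs = S′} q∈)
    ... | p′ , p′∈ , q∈′ with ∈-map⁻ (λ e → p′ List.∷ʳ proj₂ e) q∈′
    ...   | (u , d) , e∈ , refl with ∈-filterᵇ⁻ (λ e → proj₁ e ==V endpoint origin p′) FE e∈
    ...     | e∈FE , u==end = p′ , d , p′∈ , subst (λ u → (u , d) ∈ FE) (==V⇒≡ u==end) e∈FE , refl

    ∈-extensions⁺ : ∀ {p′ d} → p′ ∈ S′ → (endpoint origin p′ , d) ∈ FE → p′ List.∷ʳ d ∈ extensions
    ∈-extensions⁺ {p′} p′∈ e∈ = ∈-concatMap⁺ _ (lose p′∈ (∈-map⁺ (λ e → p′ List.∷ʳ proj₂ e)
      (∈-filterᵇ⁺ (λ e → proj₁ e ==V endpoint origin p′) e∈ (==V-refl (endpoint origin p′)))))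

    extension-of : ∀ {e} → e ∈ FE → ∃ λ p′ → p′ ∈ S′ × p′ List.∷ʳ proj₂ e ∈ extensions × lastEdge (p′ List.∷ʳ proj₂ e) ≡ e
    extension-of {u , d} e∈ with reach-M spanning (d , e∈)
    ... | p′ , p′∈ , refl = p′ , p′∈ , ∈-extensions⁺ p′∈ e∈ , lastEdge-∷ʳ p′ d

    lengths : ∀ {q} → q ∈ extensions → length q ≡ n
    lengths q∈ with ∈-extensions⁻ q∈
    ... | p′ , d , p′∈ , _ , refl = trans (length-∷ʳ p′ d) (cong suc (lengths′ p′∈))

    endpoint∈ : ∀ {q} → q ∈ extensions → endpoint origin q ∈ terminalsFrom 0 k
    endpoint∈ q∈ with ∈-extensions⁻ q∈
    ... | p′ , d , _ , e∈ , refl = subst (_∈ terminalsFrom 0 k) (sym (endpoint-∷ʳ origin p′ d))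
                                     (target-finalEdges w composition e∈)

    inits⊆ : ∀ {p′} → p′ ∈ map initSteps extensions → p′ ∈ S′
    inits⊆ p′∈ with ∈-map⁻ initSteps p′∈
    ... | q , q∈ , refl with ∈-extensions⁻ q∈
    ...   | p′ , d , p′∈S′ , _ , refl = subst (_∈ S′) (sym (initSteps-∷ʳ p′ d)) p′∈S′

    inits⊇ : ∀ {p′} → p′ ∈ S′ → p′ ∈ map initSteps extensions
    inits⊇ {p′} p′∈ with isTerminal-reducedSequence⁻ w composition _ (proj₂ (Spanning.positive spanning p′∈))
    ... | d , e∈ = subst (_∈ map initSteps extensions) (initSteps-∷ʳ p′ d) (∈-map⁺ initSteps (∈-extensions⁺ p′∈ e∈))

    endpoints⊆ : ∀ {t} → t ∈ map (endpoint origin) extensions → t ∈ terminalsFrom 0 k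
    endpoints⊆ t∈ with ∈-map⁻ (endpoint origin) t∈
    ... | q , q∈ , refl = endpoint∈ q∈

    endpoints⊇ : ∀ {t} → t ∈ terminalsFrom 0 k → t ∈ map (endpoint origin) extensions
    endpoints⊇ t∈ with finalEdges-cover w composition t∈
    ... | (u , d) , e∈ , refl with extension-of e∈
    ...   | p′ , _ , q∈ , last≡ = subst (_∈ map (endpoint origin) extensions)
              (trans (endpoint-∷ʳ origin p′ d) (cong target (trans (sym (lastEdge-∷ʳ p′ d)) last≡)))
              (∈-map⁺ (endpoint origin) q∈)

    lastEdges⊆ : ∀ {e} → e ∈ map lastEdge extensions → e ∈ FE
    lastEdges⊆ e∈ with ∈-map⁻ lastEdge e∈
    ... | q , q∈ , refl with ∈-extensions⁻ q∈
    ...   | p′ , d , _ , e∈FE , refl = subst (_∈ FE) (sym (lastEdge-∷ʳ p′ d)) e∈FE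

    lastEdges⊇ : ∀ {e} → e ∈ FE → e ∈ map lastEdge extensions
    lastEdges⊇ e∈ with extension-of e∈
    ... | p′ , _ , q∈ , last≡ = subst (_∈ map lastEdge extensions) last≡ (∈-map⁺ lastEdge q∈)

    extend≡ : extend (unionGraph n′ S′) ≡ unionGraph n extensions
    extend≡ = sym (begin
      unionGraph n extensions
        ≡⟨ unionGraph-split lengths ⟩
      attach n′ (unionGraph n′ (map initSteps extensions)) (map (endpoint origin) extensions) (map lastEdge extensions)
        ≡⟨ cong (λ γ′ → attach n′ γ′ (map (endpoint origin) extensions) (map lastEdge extensions))
                (unionGraph-cong n′ inits⊆ inits⊇) ⟩
      attach n′ (unionGraph n′ S′) (map (endpoint origin) extensions) (map lastEdge extensions)
        ≡⟨ attach-cong n′ (unionGraph n′ S′) endpoints⊆ endpoints⊇ lastEdges⊆ lastEdges⊇ ⟩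
      extend (unionGraph n′ S′) ∎)
      where open ≡-Reasoning

    extensions-spanning : Spanning m extensions
    extensions-spanning = spanning-k (λ q∈ → lengths q∈ , endpoint∈ q∈)
      (λ t∈ → let q , q∈ , t≡ = ∈-map⁻ (endpoint origin) (endpoints⊇ t∈) in q , q∈ , sym t≡)

  hasEdgeInto : ∀ {S} → Spanning m S → ∀ {t} → t ∈ terminalsFrom 0 k → HasEdgeInto (memberE n (unionGraph n S)) t
  hasEdgeInto {S} spanning t∈ = lastEdgeInto (reach-k spanning t∈)
    where
    lastEdgeInto : ∀ {t} → (∃ λ p → p ∈ S × endpoint origin p ≡ t) → HasEdgeInto (memberE n (unionGraph n S)) t
    lastEdgeInto (p , p∈ , refl) = let length≡ = trans (proj₁ (Spanning.positive spanning p∈)) sum-k in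
      lastEdge p , memberE-unionGraph⁺ length≡ p∈ (lastEdge-∈-pathEdges p length≡) , target-lastEdge p length≡

  enteredBy-word : ∀ {S} → Spanning m S → faceWord k (unionGraph n S) ≡ w →
    ∀ e → target e ∈ terminalsFrom 0 k → T (memberE n (unionGraph n S) e) ⇔ e ∈ FE
  enteredBy-word {S} spanning word≡ =
    subst (λ w′ → ∀ e → target e ∈ terminalsFrom 0 k → T (memberE n (unionGraph n S) e) ⇔ e ∈ finalEdges w′ k)
      (trans (sym (faceWord≡ (unionGraph n S))) word≡)
      (finalEdges-wordOf (memberE n (unionGraph n S)) composition (hasEdgeInto spanning))

  module Restriction {S} (spanning : Spanning m S)
    (enters : ∀ e → target e ∈ terminalsFrom 0 k → T (memberE n (unionGraph n S) e) ⇔ e ∈ FE) where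

    lengths : ∀ {p} → p ∈ S → length p ≡ n
    lengths p∈ = trans (proj₁ (Spanning.positive spanning p∈)) sum-k

    endpoint∈ : ∀ {p} → p ∈ S → endpoint origin p ∈ terminalsFrom 0 k
    endpoint∈ p∈ = terminal⇒∈ (any-==V⁻ _ (proj₂ (Spanning.positive spanning p∈)))

    lastEdge∈ : ∀ {p} → p ∈ S → lastEdge p ∈ FE
    lastEdge∈ {p} p∈ = Equivalence.to
      (enters (lastEdge p) (subst (_∈ terminalsFrom 0 k) (sym (target-lastEdge p (lengths p∈))) (endpoint∈ p∈)))
      (memberE-unionGraph⁺ (lengths p∈) p∈ (lastEdge-∈-pathEdges p (lengths p∈)))

    finalEdge⇒lastEdge : ∀ {e} → e ∈ FE → ∃ λ p → p ∈ S × lastEdge p ≡ e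
    finalEdge⇒lastEdge {u , d} e∈
      with memberE-unionGraph⁻ n S u d (Equivalence.from (enters (u , d) (target-finalEdges w composition e∈)) e∈)
    ... | p , p∈ , e∈p with ∈-pathEdges-split⁻ p (lengths p∈) e∈p
    ...   | inj₂ e≡ = p , p∈ , sym e≡
    ...   | inj₁ e∈init = ⊥-elim (1+n≰n (subst (_≤ n′) (level-terminal (target-finalEdges w composition e∈))
                              (level-target-initSteps p (lengths p∈) e∈init)))

    endpoints⊆ : ∀ {t} → t ∈ map (endpoint origin) S → t ∈ terminalsFrom 0 k
    endpoints⊆ t∈ with ∈-map⁻ (endpoint origin) t∈
    ... | p , p∈ , refl = endpoint∈ p∈

    endpoints⊇ : ∀ {t} → t ∈ terminalsFrom 0 k → t ∈ map (endpoint origin) S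
    endpoints⊇ t∈ with reach-k spanning t∈
    ... | p , p∈ , refl = ∈-map⁺ (endpoint origin) p∈

    lastEdges⊆ : ∀ {e} → e ∈ map lastEdge S → e ∈ FE
    lastEdges⊆ e∈ with ∈-map⁻ lastEdge e∈
    ... | p , p∈ , refl = lastEdge∈ p∈

    lastEdges⊇ : ∀ {e} → e ∈ FE → e ∈ map lastEdge S
    lastEdges⊇ e∈ with finalEdge⇒lastEdge e∈
    ... | p , p∈ , refl = ∈-map⁺ lastEdge p∈

    inits-spanning : Spanning M (map initSteps S)
    inits-spanning = spanning-M
      (λ q∈ → let p , p∈ , q≡ = ∈-map⁻ initSteps q∈ in
        subst (λ q → length q ≡ n′ × IsTail (endpoint origin q) FE) (sym q≡)
          (length-initSteps p (lengths p∈) , lastStep p , lastEdge∈ p∈))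
      (λ (d , e∈) → let p , p∈ , last≡ = finalEdge⇒lastEdge e∈ in initSteps p , ∈-map⁺ initSteps p∈ , cong proj₁ last≡)

    unionGraph≡extend : unionGraph n S ≡ extend (unionGraph n′ (map initSteps S))
    unionGraph≡extend = trans (unionGraph-split lengths)
      (attach-cong n′ (unionGraph n′ (map initSteps S)) endpoints⊆ endpoints⊇ lastEdges⊆ lastEdges⊇)

  private
    byPaths-M : (P : Subgraph → Set) → (∀ {S′} → Spanning M S′ → P (unionGraph n′ S′)) →
      ∀ {γ′} → γ′ ∈ facesPos M → P γ′
    byPaths-M P onUnion γ′∈ = let _ , spanning , γ′≡ = facesPos⁻ M γ′∈ in subst P (sym γ′≡) (onUnion spanning)

    byPaths-k : (P : Subgraph → Set) → (∀ {S} → Spanning m S → P (unionGraph n S)) →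
      ∀ {γ} → γ ∈ facesPos m → P γ
    byPaths-k P onUnion γ∈ = let _ , spanning , γ≡ = facesPos-k⁻ γ∈ in subst P (sym γ≡) (onUnion spanning)

  extend-face : ∀ {γ′} → γ′ ∈ facesPos M → extend γ′ ∈ facesPos m
  extend-face = byPaths-M (λ γ′ → extend γ′ ∈ facesPos m) λ spanning →
    subst (_∈ facesPos m) (sym (Extension.extend≡ spanning)) (facesPos-k⁺ (Extension.extensions-spanning spanning))

  faceWord-extend : ∀ {γ′} → γ′ ∈ facesPos M → faceWord k (extend γ′) ≡ w
  faceWord-extend = byPaths-M (λ γ′ → faceWord k (extend γ′) ≡ w) λ {S′} spanning →
    trans (faceWord≡ (extend (unionGraph n′ S′)))
      (wordOf-unique (memberE n (extend (unionGraph n′ S′))) composition w λ e te∈ →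
        memberE-attach-top n′ S′ (Extension.lengths′ spanning) {terminalsFrom 0 k} e (level-terminal te∈))

  restrict-extend : ∀ {γ′} → γ′ ∈ facesPos M → restrict (extend γ′) ≡ γ′
  restrict-extend = byPaths-M (λ γ′ → restrict (extend γ′) ≡ γ′) λ spanning →
    let open Extension spanning in
    trans (cong restrict extend≡) (trans (below-unionGraph lengths) (unionGraph-cong n′ inits⊆ inits⊇))

  dim-extend : ∀ {γ′} → γ′ ∈ facesPos M → dim (extend γ′) ≡ dim γ′ + wSize w
  dim-extend = byPaths-M (λ γ′ → dim (extend γ′) ≡ dim γ′ + wSize w) λ {S′} spanning →
    dim-attach n′ S′ (Extension.lengths′ spanning) (wSize w)
      (terminalsFrom-unique 0 composition) (finalEdges-unique w composition)
      level-terminal (level-terminal ∘ target-finalEdges w composition)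
      (trans (length-finalEdges w composition) (cong (_+ wSize w) (sym (length-terminalsFrom 0 k))))

  restrict-face : ∀ {γ} → γ ∈ facesPos m → faceWord k γ ≡ w → restrict γ ∈ facesPos M
  restrict-face = byPaths-k (λ γ → faceWord k γ ≡ w → restrict γ ∈ facesPos M) λ spanning word≡ →
    let open Restriction spanning (enteredBy-word spanning word≡) in
    subst (_∈ facesPos M) (sym (below-unionGraph lengths)) (facesPos⁺ M inits-spanning)

  extend-restrict : ∀ {γ} → γ ∈ facesPos m → faceWord k γ ≡ w → extend (restrict γ) ≡ γ
  extend-restrict = byPaths-k (λ γ → faceWord k γ ≡ w → extend (restrict γ) ≡ γ) λ spanning word≡ →
    let open Restriction spanning (enteredBy-word spanning word≡) in
    trans (cong extend (below-unionGraph lengths)) (sym unionGraph≡extend)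

  faces-with-word : ∀ d →
    length (filter (λ γ → faceWord k γ ≟W w) (filterᵇ (λ γ → dim γ ≡ᵇ d) (facesPos m)))
    ≡ length (filterᵇ (λ γ′ → (dim γ′ + wSize w) ≡ᵇ d) (facesPos M))
  faces-with-word d = ≤-antisym
    (length-≤-retract restrict extend
      (Unique.filter⁺ (λ γ → faceWord k γ ≟W w) (Unique-filterᵇ (λ γ → dim γ ≡ᵇ d) (facesPos-unique m)))
      restrict-∈ (proj₂ ∘ ∈xs⁻))
    (length-≤-retract extend restrict (Unique-filterᵇ (λ γ′ → (dim γ′ + wSize w) ≡ᵇ d) (facesPos-unique M))
      extend-∈ restrict-extend′)
    where
    xs = filter (λ γ → faceWord k γ ≟W w) (filterᵇ (λ γ → dim γ ≡ᵇ d) (facesPos m))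
    ys = filterᵇ (λ γ′ → (dim γ′ + wSize w) ≡ᵇ d) (facesPos M)
    ∈xs⁻ : ∀ {γ} → γ ∈ xs → (γ ∈ facesPos m × dim γ ≡ d × faceWord k γ ≡ w) × extend (restrict γ) ≡ γ
    ∈xs⁻ {γ} γ∈ = let γ∈′ , word≡ = ∈-filter⁻ (λ γ → faceWord k γ ≟W w) {xs = filterᵇ (λ γ → dim γ ≡ᵇ d) (facesPos m)} γ∈
                      γ∈faces , dim≡ = ∈-filterᵇ⁻ (λ γ → dim γ ≡ᵇ d) (facesPos m) γ∈′ in
      (γ∈faces , ≡ᵇ⇒≡ (dim γ) d dim≡ , word≡) , extend-restrict γ∈faces word≡
    restrict-∈ : ∀ {γ} → γ ∈ xs → restrict γ ∈ ys
    restrict-∈ {γ} γ∈ = let (γ∈faces , dim≡ , word≡) , round = ∈xs⁻ γ∈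
                            γ′∈ = restrict-face γ∈faces word≡ in
      ∈-filterᵇ⁺ _ γ′∈ (≡⇒≡ᵇ _ d (trans (sym (dim-extend γ′∈)) (trans (cong dim round) dim≡)))
    ∈ys⁻ : ∀ {γ′} → γ′ ∈ ys → γ′ ∈ facesPos M × dim γ′ + wSize w ≡ d
    ∈ys⁻ {γ′} γ′∈ = let γ′∈faces , dim≡ = ∈-filterᵇ⁻ _ (facesPos M) γ′∈ in γ′∈faces , ≡ᵇ⇒≡ _ d dim≡
    extend-∈ : ∀ {γ′} → γ′ ∈ ys → extend γ′ ∈ xs
    extend-∈ γ′∈ = let γ′∈faces , dim≡ = ∈ys⁻ γ′∈ in
      ∈-filter⁺ (λ γ → faceWord k γ ≟W w)
        (∈-filterᵇ⁺ (λ γ → dim γ ≡ᵇ d) (extend-face γ′∈faces) (≡⇒≡ᵇ _ d (trans (dim-extend γ′∈faces) dim≡)))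
        (faceWord-extend γ′∈faces)
    restrict-extend′ : ∀ {γ′} → γ′ ∈ ys → restrict (extend γ′) ≡ γ′
    restrict-extend′ = restrict-extend ∘ proj₁ ∘ ∈ys⁻

-- Counting

indicator : ∀ {P : Set} → Dec P → ℕ
indicator P? = if does P? then 1 else 0

module _ {A : Set} where

  length-filter-∷ : ∀ {P : A → Set} (P? : ∀ x → Dec (P x)) x xs →
    length (filter P? (x ∷ xs)) ≡ indicator (P? x) + length (filter P? xs)
  length-filter-∷ P? x xs with does (P? x)
  ... | true  = refl
  ... | false = refl

  sum-map-+ : ∀ (f g : A → ℕ) xs → sum (map (λ x → f x + g x) xs) ≡ sum (map f xs) + sum (map g xs)
  sum-map-+ f g []       = refl
  sum-map-+ f g (x ∷ xs) = trans (cong (f x + g x +_) (sum-map-+ f g xs))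
    (solve 4 (λ a b c d → a :+ b :+ (c :+ d) := a :+ c :+ (b :+ d)) refl (f x) (g x) (sum (map f xs)) (sum (map g xs)))

  sum-map-0 : ∀ (xs : List A) → sum (map (λ _ → 0) xs) ≡ 0
  sum-map-0 []       = refl
  sum-map-0 (_ ∷ xs) = sum-map-0 xs

  filterᵇ-cong : ∀ {f g : A → Bool} → (∀ x → f x ≡ g x) → ∀ xs → filterᵇ f xs ≡ filterᵇ g xs
  filterᵇ-cong f≗g = List.filter-≐ (T? ∘ _) (T? ∘ _) ((λ {x} → subst T (f≗g x)) , (λ {x} → subst T (sym (f≗g x))))

sum-concatMap : ∀ {A B : Set} (f : B → ℕ) (g : A → List B) xs →
  sum (map f (concatMap g xs)) ≡ sum (map (λ x → sum (map f (g x))) xs)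
sum-concatMap f g []       = refl
sum-concatMap f g (x ∷ xs) = begin
  sum (map f (g x ++ concatMap g xs))                 ≡⟨ cong sum (List.map-++ f (g x) (concatMap g xs)) ⟩
  sum (map f (g x) ++ map f (concatMap g xs))         ≡⟨ NatList.sum-++ (map f (g x)) (map f (concatMap g xs)) ⟩
  sum (map f (g x)) + sum (map f (concatMap g xs))    ≡⟨ cong (sum (map f (g x)) +_) (sum-concatMap f g xs) ⟩
  sum (map f (g x)) + sum (map (λ x → sum (map f (g x))) xs) ∎
  where open ≡-Reasoning

occurrences-allW : ∀ {r} (v : Vec Letter r) → sum (map (λ w → indicator (v ≟W w)) (allW r)) ≡ 1
occurrences-allW []          = refl
occurrences-allW {suc r} (l ∷ v) = begin
  sum (map (λ w → indicator ((l ∷ v) ≟W w)) (allW (suc r)))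
    ≡⟨ sum-concatMap (λ w → indicator ((l ∷ v) ≟W w)) (λ u → (l10 ∷ u) ∷ (l01 ∷ u) ∷ (l11 ∷ u) ∷ []) (allW r) ⟩
  sum (map (λ u → indicator ((l ∷ v) ≟W (l10 ∷ u)) + (indicator ((l ∷ v) ≟W (l01 ∷ u)) + (indicator ((l ∷ v) ≟W (l11 ∷ u)) + 0))) (allW r))
    ≡⟨ cong sum (List.map-cong (oneLetterMatches l) (allW r)) ⟩
  sum (map (λ u → indicator (v ≟W u)) (allW r))
    ≡⟨ occurrences-allW v ⟩
  1 ∎
  where
  open ≡-Reasoning
  oneLetterMatches : ∀ l u → indicator ((l ∷ v) ≟W (l10 ∷ u)) + (indicator ((l ∷ v) ≟W (l01 ∷ u))
    + (indicator ((l ∷ v) ≟W (l11 ∷ u)) + 0)) ≡ indicator (v ≟W u)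
  oneLetterMatches l u with does (v ≟W u)
  oneLetterMatches l10 u | true  = refl
  oneLetterMatches l01 u | true  = refl
  oneLetterMatches l11 u | true  = refl
  oneLetterMatches l10 u | false = refl
  oneLetterMatches l01 u | false = refl
  oneLetterMatches l11 u | false = refl

partition-by-word : ∀ {A : Set} {r} (h : A → Vec Letter r) (L : List A) →
  length L ≡ sum (map (λ w → length (filter (λ x → h x ≟W w) L)) (allW r))
partition-by-word {r = r} h []      = sym (sum-map-0 (allW r))
partition-by-word {r = r} h (x ∷ L) = begin
  1 + length L
    ≡⟨ cong₂ _+_ (sym (occurrences-allW (h x))) (partition-by-word h L) ⟩
  sum (map (λ w → indicator (h x ≟W w)) (allW r)) + sum (map (λ w → length (filter (λ y → h y ≟W w) L)) (allW r))
    ≡⟨ sum-map-+ (λ w → indicator (h x ≟W w)) (λ w → length (filter (λ y → h y ≟W w) L)) (allW r) ⟨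
  sum (map (λ w → indicator (h x ≟W w) + length (filter (λ y → h y ≟W w) L)) (allW r))
    ≡⟨ cong sum (List.map-cong (λ w → sym (length-filter-∷ (λ y → h y ≟W w) x L)) (allW r)) ⟩
  sum (map (λ w → length (filter (λ y → h y ≟W w) (x ∷ L))) (allW r)) ∎
  where open ≡-Reasoning

mulT-count : ∀ {A : Set} (deg : A → ℕ) (L : List A) e d →
  mulT e (λ d′ → length (filterᵇ (λ x → deg x ≡ᵇ d′) L)) d ≡ length (filterᵇ (λ x → (deg x + e) ≡ᵇ d) L)
mulT-count deg L zero    d       = cong length (filterᵇ-cong (λ x → cong (_≡ᵇ d) (sym (+-identityʳ (deg x)))) L)
mulT-count deg L (suc e) zero    = sym (cong length (trans (filterᵇ-cong (λ x → cong (_≡ᵇ 0) (+-suc (deg x) e)) L)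
  (List.filter-none (T? ∘ λ _ → false) {xs = L} (All.tabulate (λ _ ())))))
mulT-count deg L (suc e) (suc d) = trans (mulT-count deg L e d)
  (cong length (filterᵇ-cong (λ x → cong (_≡ᵇ suc d) (sym (+-suc (deg x) e))) L))

sumP-map : ∀ {A : Set} (P : A → Poly) xs d → sumP (map P xs) d ≡ sum (map (λ x → P x d) xs)
sumP-map P []       d = refl
sumP-map P (x ∷ xs) d = cong (P x d +_) (sumP-map P xs d)

dropZeros-toList : ∀ {r} {k : Vec ℕ r} → IsComposition k → dropZeros (toList k) ≡ toList k
dropZeros-toList {k = []}        []               = refl
dropZeros-toList {k = suc a ∷ k} (_ ∷ composition) = cong (suc a ∷_) (dropZeros-toList composition)

lemma3p7 : (r : ℕ) (k : Vec ℕ (suc r)) → All (1 ≤_) k → (d : ℕ) →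
    F (Data.Vec.toList k) d
      ≡ sumP (map (λ w → mulT (wSize w) (F (interleave (rW w k) (wTilde w)))) (allW r)) d
lemma3p7 r k composition d = begin
  F (toList k) d
    ≡⟨ cong (λ m → length (filterᵇ (λ γ → dim γ ≡ᵇ d) (facesPos m))) (dropZeros-toList composition) ⟩
  length facesOfDim
    ≡⟨ partition-by-word (faceWord k) facesOfDim ⟩
  sum (map (λ w → length (filter (λ γ → faceWord k γ ≟W w) facesOfDim)) (allW r))
    ≡⟨ cong sum (List.map-cong (λ w → trans (Reduction.faces-with-word composition w d)
                                           (sym (mulT-count dim (facesPos (reducedSequence w k)) (wSize w) d))) (allW r)) ⟩
  sum (map (λ w → mulT (wSize w) (F (interleave (rW w k) (wTilde w))) d) (allW r))
    ≡⟨ sumP-map (λ w → mulT (wSize w) (F (interleave (rW w k) (wTilde w)))) (allW r) d ⟨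
  sumP (map (λ w → mulT (wSize w) (F (interleave (rW w k) (wTilde w)))) (allW r)) d ∎
  where
  open ≡-Reasoning
  facesOfDim = filterᵇ (λ γ → dim γ ≡ᵇ d) (facesPos (toList k))
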